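{- Let $(\alpha_n)_{n\ge0}$ be a sequence of complex numbers and $A_n(x)=\sum_{\nu=0}^{n}\binom{n}{\nu}\alpha_{n-\nu}x^\nu$ the associated Appell polynomials. Assume $A_m(1-x)=(-1)^mA_m(x)$ for all $m\ge0$. Let $n\ge1$ be odd and $d_n=\lfloor n/2\rfloor=(n-1)/2$. Then there is a unique polynomial $F_n(u)=\sum_{k\ge0}f_{n,k}u^k$ with $$A_n(x)=(2x-1)\,F_n\big(x(x-1)\big),$$ and its coefficients satisfy, for all $k\ge0$, $$(-1)^k f_{n,k}=[x^k]\,C_{n,2k}(x)=\frac{1}{k!}\,G_{n,2k}^{(k)}(1).$$ Moreover, $C_{n,2k}(x)$ is a formal power series in $\mathbb{C}[[x]]$ if $0\le k\le d_n$, and a polynomial in $\mathbb{C}[x]$ if $k>d_n$; in the latter case it is anti-palindromic, i.e. $C_{n,2k}(x)=-x^{2k}C_{n,2k}(x^{ -1})$. The coefficients satisfy $f_{n,0}=-\alpha_n$, $f_{n,d_n}=\tfrac12\alpha_0$, and $f_{n,k}=0$ for $k>d_n$. For $0\le k\le n$, $$f_{n,k}=(-1)^k\sum_{\nu=0}^{k}\binom{2k-n}{k-\nu}a_{n,\nu}=(-1)^{k+1}\sum_{\nu=0}^{k}\binom{2k-\nu}{k}\binom{n}{\nu}\alpha_{n-\nu}.$$ Furthermore, there is a unique polynomial $F_{n+1}(u)=\sum_{k\ge0}f_{n+1,k}u^k$ with $A_{n+1}(x)=F_{n+1}(x(x-1))$, and with $d_{n+1}=\lfloor (n+1)/2\rfloor$,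 $$f_{n+1,k}=\begin{cases}\alpha_{n+1}, & k=0,\\ \frac{n+1}{k}\,f_{n,k-1}, & 1\le k<d_{n+1},\\ \alpha_0, & k=d_{n+1},\\ 0,& k>d_{n+1}.\end{cases}$$
   Context: Here $\alpha_0=0$ is allowed. For $m\ge0$ and $j\in\mathbb{Z}$, $G_{m,j}(x)=x^jA_m(x^{ -1})$ (a function of $x\ne0$; $G^{(k)}$ denotes the $k$-th derivative in $x$). For $0\le k\le m$, $a_{m,k}=\sum_{\nu=k}^{m}\binom{m}{\nu}\binom{\nu}{k}\alpha_\nu$, and $C_m(x)=\sum_{k=0}^{m}a_{m,k}x^k$. For $j\in\mathbb{Z}$, $C_{m,j}(x)$ is the formal power series $C_m(x)(x+1)^{j-m}=C_m(x)\sum_{\nu\ge0}\binom{j-m}{\nu}x^\nu$ (generalized binomial coefficients, so $\binom{c}{\nu}$ is defined for negative integers $c$), and $[x^k]$ denotes the coefficient of $x^k$. -}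

module Defs where

open import Level using (_⊔_)
open import Algebra.Bundles using (CommutativeRing)
open import Data.Nat as ℕ using (ℕ; zero; suc; _∸_)
open import Data.Nat.Combinatorics using (_C_)
open import Data.Integer as ℤ using (ℤ; +_; -[1+_])
open import Data.List using (List; []; _∷_; map; foldr; applyUpTo)
open import Data.Product using (_×_; _,_; ∃)
open import Relation.Nullary using (¬_)

-- Generalized binomial coefficient binom(c, ν) for c ∈ ℤ, ν ∈ ℕ
-- (= c(c-1)…(c-ν+1)/ν!).  For c ≥ 0 it is the usual one; for
-- c = -(m+1) it is (-1)^ν binom(m+ν, ν).
gbinom : ℤ → ℕ → ℤ
gbinom (+ n)      ν = + (n C ν)
gbinom -[1+ m ]   ν = (ℤ.- (ℤ.+ 1)) ℤ.^ ν ℤ.* (+ ((m ℕ.+ ν) C ν))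

ffall : ℤ → ℕ → ℤ
ffall e zero    = + 1
ffall e (suc k) = e ℤ.* ffall (e ℤ.- + 1) k

-- Everything below lives over a commutative ring R
-- (the theorem instantiates R to a field of characteristic 0, standing in for ℂ).
module Over {c ℓ} (R : CommutativeRing c ℓ) where
  open CommutativeRing R

  fromℕ : ℕ → Carrier
  fromℕ zero    = 0#
  fromℕ (suc n) = 1# + fromℕ n

  fromℤ : ℤ → Carrier
  fromℤ (+ n)     = fromℕ n
  fromℤ -[1+ n ]  = - fromℕ (suc n)

  pow : Carrier → ℕ → Carrier
  pow x zero    = 1#
  pow x (suc k) = x * pow x k

  sgn : ℕ → Carrier
  sgn k = pow (- 1#) k

  sumTo : ℕ → (ℕ → Carrier) → Carrier
  sumTo zero    f = f 0
  sumTo (suc n) f = sumTo n f + f (suc n)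

  -- Σ_{i = k}^{m} f i   (empty, i.e. 0#, if m < k)
  sumFromTo : ℕ → ℕ → (ℕ → Carrier) → Carrier
  sumFromTo k m f = foldr _+_ 0# (applyUpTo (λ i → f (k ℕ.+ i)) (suc m ∸ k))

  -- Polynomials in one variable: coefficient lists, index i = coeff of x^i
  Poly : Set c
  Poly = List Carrier

  coeff : Poly → ℕ → Carrier
  coeff []       _       = 0#
  coeff (a ∷ p)  zero    = a
  coeff (a ∷ p)  (suc i) = coeff p i

  _≋_ : Poly → Poly → Set ℓ
  p ≋ q = ∀ i → coeff p i ≈ coeff q i

  infix 4 _≋_

  _+P_ : Poly → Poly → Poly
  []      +P q       = q
  (a ∷ p) +P []      = a ∷ p
  (a ∷ p) +P (b ∷ q) = (a + b) ∷ (p +P q)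

  scaleP : Carrier → Poly → Poly
  scaleP a p = map (a *_) p

  _*P_ : Poly → Poly → Poly
  []      *P q = []
  (a ∷ p) *P q = scaleP a q +P (0# ∷ (p *P q))

  _∘P_ : Poly → Poly → Poly
  p ∘P q = foldr (λ a acc → (a ∷ []) +P (q *P acc)) [] p

  uPoly : Poly
  uPoly = 0# ∷ (- 1#) ∷ 1# ∷ []

  twoXminus1 : Poly
  twoXminus1 = (- 1#) ∷ fromℕ 2 ∷ []

  oneMinusX : Poly
  oneMinusX = 1# ∷ (- 1#) ∷ []

  FPS : Set c
  FPS = ℕ → Carrier

  toFPS : Poly → FPS
  toFPS = coeff

  _*S_ : FPS → FPS → FPS
  (f *S g) i = sumTo i (λ t → f t * g (i ∸ t))

  -- (1 + x)^c = Σ_ν binom(c,ν) x^ν,  c ∈ ℤ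
  binomSeries : ℤ → FPS
  binomSeries e ν = fromℤ (gbinom e ν)

  IsPolynomial : FPS → Set ℓ
  IsPolynomial s = ∃ λ N → ∀ i → N ℕ.≤ i → s i ≈ 0#

  -- s(x) = - x^m s(x⁻¹) as an identity of (Laurent) polynomials:
  -- s has no terms of degree > m and s_i = - s_{m-i} for i ≤ m
  AntiPalindromic : ℕ → FPS → Set ℓ
  AntiPalindromic m s = (∀ i → m ℕ.< i → s i ≈ 0#)
                      × (∀ i → i ℕ.≤ m → s i ≈ - s (m ∸ i))

  -- Laurent polynomials: finite lists of terms (coefficient, exponent ∈ ℤ)
  LPoly : Set c
  LPoly = List (Carrier × ℤ)

  derivL : LPoly → LPoly
  derivL = map (λ { (a , e) → (fromℤ e * a , e ℤ.- + 1) })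

  derivLⁿ : ℕ → LPoly → LPoly
  derivLⁿ zero    p = p
  derivLⁿ (suc k) p = derivL (derivLⁿ k p)

  powℤ : Carrier → Carrier → ℤ → Carrier
  powℤ x x' (+ n)     = pow x n
  powℤ x x' -[1+ n ]  = pow x' (suc n)

  evalL : Carrier → Carrier → LPoly → Carrier
  evalL x x' = foldr (λ { (a , e) acc → a * powℤ x x' e + acc }) 0#

  Appell : (ℕ → Carrier) → ℕ → Poly
  Appell α n = applyUpTo (λ ν → fromℕ (n C ν) * α (n ∸ ν)) (suc n)

  -- G_{m,j}(x) = x^j A_m(x⁻¹) = Σ_ν binom(m,ν) α_{m-ν} x^{j-ν}
  G : (ℕ → Carrier) → ℕ → ℤ → LPoly
  G α m j = applyUpTo (λ ν → (fromℕ (m C ν) * α (m ∸ ν) , j ℤ.- + ν)) (suc m)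

  aCoef : (ℕ → Carrier) → ℕ → ℕ → Carrier
  aCoef α m k = sumFromTo k m (λ ν → fromℕ (m C ν) * (fromℕ (ν C k) * α ν))

  Cpoly : (ℕ → Carrier) → ℕ → Poly
  Cpoly α m = applyUpTo (aCoef α m) (suc m)

  Cser : (ℕ → Carrier) → ℕ → ℤ → FPS
  Cser α m j = toFPS (Cpoly α m) *S binomSeries (j ℤ.- + m)

  IsCharZeroField : Set (c ⊔ ℓ)
  IsCharZeroField = (∀ x → ¬ (x ≈ 0#) → ∃ λ y → x * y ≈ 1#)
                  × (∀ n → ¬ (fromℕ (suc n) ≈ 0#))

-- Substituting x = (1 + y)/2 turns the reflection A_n(1 - x) = -A_n(x) (n odd) into oddness of
-- B(y) = A_n((1 + y)/2), so B(y) = y G(y²); since (2x - 1)² = 1 + 4x(x - 1), F_n(u) = G(1 + 4u)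
-- gives A_n = (2x - 1) F_n(x(x - 1)).  It is unique because 2x - 1 and (x - 1) are units of R[[x]],
-- so that composing with x(x - 1) is injective.
--
-- The coefficient formulas are read off in R[[t]] after substituting x = 1/(1 + t).  The left side
-- becomes C_{n,j}(t) = (1 + t)^j A_n(1/(1 + t)); for j = 2k the right side becomes
-- Σ_i f_{n,i} (-t)^i (1 - t)(1 + t)^(2(k - i) - 1), and [t^m] (1 - t)(1 + t)^(2m - 1) vanishes for
-- m ≥ 1, so [t^k] C_{n,2k} = (-1)^k f_{n,k}.  Under this substitution the reflection becomes
-- t ↦ t/(1 + t), which makes C_{n,N} (N ≥ n) an anti-palindromic polynomial of degree N; its middle
-- coefficient vanishes, whence f_{n,k} = 0 for k > d.  Finally A_{n+1}′ = (n + 1) A_n, so F_{n+1} is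
-- α_{n+1} plus (n + 1) times an antiderivative of F_n.

module Submission where

open import Defs
open import Algebra.Bundles using (CommutativeRing)
open import Data.Nat as ℕ using (ℕ)
open import Data.Nat.Combinatorics as Comb using ()
open import Data.Nat.DivMod as DM using ()
open import Data.Integer as ℤ using ()
open import Data.Product using (Σ)
open import Data.Product using (_×_)
open import Relation.Binary.PropositionalEquality using (_≡_)

open import Data.Nat using (zero; suc; _≤_; _<_; _∸_; z≤n; s≤s; _!)
import Data.Nat.Properties as ℕP
open import Data.Nat.Combinatorics using (_C_; nCk+nC[k+1]≡[n+1]C[k+1]; nCk≡nC[n∸k]; nCn≡1; nC1≡n; k>n⇒nCk≡0)
open import Data.Nat.Solver using (module +-*-Solver)
open import Data.Integer using (ℤ; +_; -[1+_])
import Data.Integer.Properties as ℤP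
open import Data.Sign as Sign using (Sign)
open import Data.List using ([]; _∷_; foldr; applyUpTo; length)
open import Data.Product using (_,_; proj₁; proj₂)
open import Data.Maybe using (Maybe; just; nothing)
open import Data.Empty using (⊥-elim)
open import Relation.Nullary using (Dec; yes; no)
open import Relation.Binary using (tri<; tri≈; tri>)
import Relation.Binary.PropositionalEquality as P
open import Relation.Binary.PropositionalEquality using (_≢_)
import Algebra.Solver.Ring as RingSolver
import Algebra.Solver.Ring.AlmostCommutativeRing as ACR
import Algebra.Properties.Ring as RingProperties
import Algebra.Properties.CommutativeSemigroup as CommSemigroupProperties
import Relation.Binary.Reasoning.Setoid as SetoidReasoning

module Numerals {c ℓ} (R : CommutativeRing c ℓ) where
  open CommutativeRing R
  open Over R
  open RingProperties ring public

  open CommSemigroupProperties *-commutativeSemigroup using () renaming (interchange to *-interchange)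

  module ≈-Reasoning = SetoidReasoning setoid

  fromℕ-+ : ∀ m n → fromℕ (m ℕ.+ n) ≈ fromℕ m + fromℕ n
  fromℕ-+ zero    n = sym (+-identityˡ _)
  fromℕ-+ (suc m) n = trans (+-congˡ (fromℕ-+ m n)) (sym (+-assoc _ _ _))

  fromℕ-* : ∀ m n → fromℕ (m ℕ.* n) ≈ fromℕ m * fromℕ n
  fromℕ-* zero    n = sym (zeroˡ _)
  fromℕ-* (suc m) n = begin
    fromℕ (n ℕ.+ m ℕ.* n)             ≈⟨ fromℕ-+ n (m ℕ.* n) ⟩
    fromℕ n + fromℕ (m ℕ.* n)         ≈⟨ +-cong (sym (*-identityˡ _)) (fromℕ-* m n) ⟩
    1# * fromℕ n + fromℕ m * fromℕ n  ≈⟨ sym (distribʳ _ _ _) ⟩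
    (1# + fromℕ m) * fromℕ n          ∎
    where open ≈-Reasoning

  fromℤ-⊖ : ∀ m n → fromℤ (m ℤ.⊖ n) ≈ fromℕ m - fromℕ n
  fromℤ-⊖ zero    zero    = sym (-‿inverseʳ 0#)
  fromℤ-⊖ (suc m) zero    = sym (trans (+-congˡ -0#≈0#) (+-identityʳ _))
  fromℤ-⊖ zero    (suc n) = sym (+-identityˡ _)
  fromℤ-⊖ (suc m) (suc n) = begin
    fromℤ (suc m ℤ.⊖ suc n)          ≡⟨ P.cong fromℤ (ℤP.[1+m]⊖[1+n]≡m⊖n m n) ⟩
    fromℤ (m ℤ.⊖ n)                  ≈⟨ fromℤ-⊖ m n ⟩
    fromℕ m - fromℕ n                ≈⟨ sym ([a+x]-[a+y]≈x-y 1# (fromℕ m) (fromℕ n)) ⟩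
    (1# + fromℕ m) - (1# + fromℕ n)  ∎
    where
    open ≈-Reasoning
    [a+x]-[a+y]≈x-y : ∀ a x y → (a + x) - (a + y) ≈ x - y
    [a+x]-[a+y]≈x-y a x y = begin
      (a + x) + - (a + y)    ≈⟨ +-congˡ (sym (-‿+-comm a y)) ⟩
      (a + x) + (- a + - y)  ≈⟨ +-cong (+-comm a x) (+-comm (- a) (- y)) ⟩
      (x + a) + (- y + - a)  ≈⟨ +-assoc _ _ _ ⟩
      x + (a + (- y + - a))  ≈⟨ +-congˡ (trans (+-comm _ _) (+-assoc _ _ _)) ⟩
      x + (- y + (- a + a))  ≈⟨ +-congˡ (+-congˡ (-‿inverseˡ a)) ⟩
      x + (- y + 0#)         ≈⟨ +-congˡ (+-identityʳ _) ⟩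
      x - y                  ∎

  fromℤ-neg : ∀ i → fromℤ (ℤ.- i) ≈ - fromℤ i
  fromℤ-neg (+ zero)  = sym -0#≈0#
  fromℤ-neg (+ suc n) = refl
  fromℤ-neg -[1+ n ]  = sym (-‿involutive _)

  fromℤ-+ : ∀ i j → fromℤ (i ℤ.+ j) ≈ fromℤ i + fromℤ j
  fromℤ-+ (+ m)     (+ n)     = fromℕ-+ m n
  fromℤ-+ (+ m)     -[1+ n ]  = fromℤ-⊖ m (suc n)
  fromℤ-+ -[1+ m ]  (+ n)     = trans (fromℤ-⊖ n (suc m)) (+-comm _ _)
  fromℤ-+ -[1+ m ]  -[1+ n ]  = begin
    - (1# + fromℕ (suc (m ℕ.+ n)))       ≈⟨ -‿cong (+-congˡ (fromℕ-+ (suc m) n)) ⟩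
    - (1# + (fromℕ (suc m) + fromℕ n))   ≈⟨ -‿cong (trans (sym (+-assoc _ _ _)) (+-congʳ (+-comm _ _))) ⟩
    - ((fromℕ (suc m) + 1#) + fromℕ n)   ≈⟨ -‿cong (+-assoc _ _ _) ⟩
    - (fromℕ (suc m) + fromℕ (suc n))    ≈⟨ sym (-‿+-comm _ _) ⟩
    - fromℕ (suc m) + - fromℕ (suc n)    ∎
    where open ≈-Reasoning

  fromSign : Sign → Carrier
  fromSign Sign.+ = 1#
  fromSign Sign.- = - 1#

  fromSign-* : ∀ s t → fromSign (s Sign.* t) ≈ fromSign s * fromSign t
  fromSign-* Sign.+ t      = sym (*-identityˡ _)
  fromSign-* Sign.- Sign.+ = sym (*-identityʳ _)
  fromSign-* Sign.- Sign.- = trans (sym (-‿involutive 1#)) (trans (-‿cong (sym (*-identityʳ _))) (-‿distribʳ-* _ _))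

  fromℤ-◃ : ∀ s n → fromℤ (s ℤ.◃ n) ≈ fromSign s * fromℕ n
  fromℤ-◃ s      zero    = sym (zeroʳ _)
  fromℤ-◃ Sign.+ (suc n) = sym (*-identityˡ _)
  fromℤ-◃ Sign.- (suc n) = trans (-‿cong (sym (*-identityˡ _))) (-‿distribˡ-* _ _)

  fromℤ-signAbs : ∀ i → fromℤ i ≈ fromSign (ℤ.sign i) * fromℕ ℤ.∣ i ∣
  fromℤ-signAbs i = trans (reflexive (P.cong fromℤ (P.sym (ℤP.◃-inverse i)))) (fromℤ-◃ (ℤ.sign i) ℤ.∣ i ∣)

  fromℤ-* : ∀ i j → fromℤ (i ℤ.* j) ≈ fromℤ i * fromℤ j
  fromℤ-* i j = begin
    fromℤ (i ℤ.* j)                        ≈⟨ fromℤ-◃ (s Sign.* t) (a ℕ.* b) ⟩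
    fromSign (s Sign.* t) * fromℕ (a ℕ.* b) ≈⟨ *-cong (fromSign-* s t) (fromℕ-* a b) ⟩
    (fromSign s * fromSign t) * (fromℕ a * fromℕ b) ≈⟨ *-interchange _ _ _ _ ⟩
    (fromSign s * fromℕ a) * (fromSign t * fromℕ b) ≈⟨ sym (*-cong (fromℤ-signAbs i) (fromℤ-signAbs j)) ⟩
    fromℤ i * fromℤ j                      ∎
    where
    open ≈-Reasoning
    s t : Sign
    s = ℤ.sign i
    t = ℤ.sign j
    a b : ℕ
    a = ℤ.∣ i ∣
    b = ℤ.∣ j ∣

  -- Unlike fromℕ, fromℕ′ 1 is 1# on the nose, so the solver's constants 0 and 1 are literally 0# and 1#.
  fromℕ′ : ℕ → Carrier
  fromℕ′ zero          = 0#
  fromℕ′ (suc zero)    = 1#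
  fromℕ′ (suc (suc n)) = 1# + fromℕ′ (suc n)

  fromℤ′ : ℤ → Carrier
  fromℤ′ (+ n)     = fromℕ′ n
  fromℤ′ -[1+ n ]  = - fromℕ′ (suc n)

  fromℕ′≈fromℕ : ∀ n → fromℕ′ n ≈ fromℕ n
  fromℕ′≈fromℕ zero          = refl
  fromℕ′≈fromℕ (suc zero)    = sym (+-identityʳ 1#)
  fromℕ′≈fromℕ (suc (suc n)) = +-congˡ (fromℕ′≈fromℕ (suc n))

  fromℤ′≈fromℤ : ∀ i → fromℤ′ i ≈ fromℤ i
  fromℤ′≈fromℤ (+ n)    = fromℕ′≈fromℕ n
  fromℤ′≈fromℤ -[1+ n ] = -‿cong (fromℕ′≈fromℕ (suc n))

  ℤ⟶R : ℤ.+-*-rawRing ACR.-Raw-AlmostCommutative⟶ ACR.fromCommutativeRing R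
  ℤ⟶R = record
    { ⟦_⟧    = fromℤ′
    ; +-homo = λ i j → trans (fromℤ′≈fromℤ (i ℤ.+ j))
                         (trans (fromℤ-+ i j) (sym (+-cong (fromℤ′≈fromℤ i) (fromℤ′≈fromℤ j))))
    ; *-homo = λ i j → trans (fromℤ′≈fromℤ (i ℤ.* j))
                         (trans (fromℤ-* i j) (sym (*-cong (fromℤ′≈fromℤ i) (fromℤ′≈fromℤ j))))
    ; -‿homo = λ i → trans (fromℤ′≈fromℤ (ℤ.- i)) (trans (fromℤ-neg i) (sym (-‿cong (fromℤ′≈fromℤ i))))
    ; 0-homo = refl
    ; 1-homo = refl
    }

  fromℤ′-≟ : ∀ i j → Maybe (fromℤ′ i ≈ fromℤ′ j)
  fromℤ′-≟ i j with i ℤ.≟ j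
  ... | yes P.refl = just refl
  ... | no _       = nothing

  module Solver = RingSolver ℤ.+-*-rawRing (ACR.fromCommutativeRing R) ℤ⟶R fromℤ′-≟

  pow-distrib-* : ∀ x y j → pow (x * y) j ≈ pow x j * pow y j
  pow-distrib-* x y zero    = sym (*-identityˡ 1#)
  pow-distrib-* x y (suc j) = trans (*-congˡ (pow-distrib-* x y j)) (*-interchange x y (pow x j) (pow y j))

  sgn-suc : ∀ k → sgn (suc k) ≈ - sgn k
  sgn-suc k = trans (sym (-‿distribˡ-* 1# (sgn k))) (-‿cong (*-identityˡ _))

  sgn-involutive : ∀ k → sgn k * sgn k ≈ 1#
  sgn-involutive zero    = *-identityˡ _
  sgn-involutive (suc k) = begin
    sgn (suc k) * sgn (suc k) ≈⟨ *-cong (sgn-suc k) (sgn-suc k) ⟩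
    - sgn k * - sgn k         ≈⟨ -x*-y≈x*y _ _ ⟩
    sgn k * sgn k             ≈⟨ sgn-involutive k ⟩
    1#                        ∎
    where
    open ≈-Reasoning
    -x*-y≈x*y : ∀ x y → - x * - y ≈ x * y
    -x*-y≈x*y x y = trans (sym (-‿distribˡ-* _ _)) (trans (-‿cong (sym (-‿distribʳ-* _ _))) (-‿involutive _))

  sgn-even : ∀ d → sgn (d ℕ.+ d) ≈ 1#
  sgn-even zero    = refl
  sgn-even (suc d) = begin
    sgn (suc (d ℕ.+ suc d))       ≡⟨ P.cong (λ z → sgn (suc z)) (ℕP.+-suc d d) ⟩
    sgn (suc (suc (d ℕ.+ d)))     ≈⟨ trans (sgn-suc (suc (d ℕ.+ d))) (-‿cong (sgn-suc (d ℕ.+ d))) ⟩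
    - - sgn (d ℕ.+ d)             ≈⟨ -‿involutive _ ⟩
    sgn (d ℕ.+ d)                 ≈⟨ sgn-even d ⟩
    1#                            ∎
    where open ≈-Reasoning

  fromℤ-[-1]^ : ∀ ν → fromℤ ((ℤ.- + 1) ℤ.^ ν) ≈ sgn ν
  fromℤ-[-1]^ zero    = +-identityʳ 1#
  fromℤ-[-1]^ (suc ν) = trans (fromℤ-* (ℤ.- + 1) ((ℤ.- + 1) ℤ.^ ν))
    (*-cong (-‿cong (+-identityʳ 1#)) (fromℤ-[-1]^ ν))

module FiniteSums {c ℓ} (R : CommutativeRing c ℓ) where
  open CommutativeRing R
  open Over R
  open Numerals R

  sumTo-cong-≤ : ∀ n {f g} → (∀ t → t ≤ n → f t ≈ g t) → sumTo n f ≈ sumTo n g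
  sumTo-cong-≤ zero    h = h 0 z≤n
  sumTo-cong-≤ (suc n) h = +-cong (sumTo-cong-≤ n (λ t t≤n → h t (ℕP.m≤n⇒m≤1+n t≤n))) (h (suc n) ℕP.≤-refl)

  sumTo-cong : ∀ n {f g} → (∀ t → f t ≈ g t) → sumTo n f ≈ sumTo n g
  sumTo-cong n h = sumTo-cong-≤ n (λ t _ → h t)

  sumTo-+ : ∀ n f g → sumTo n (λ t → f t + g t) ≈ sumTo n f + sumTo n g
  sumTo-+ zero    f g = refl
  sumTo-+ (suc n) f g = begin
    sumTo n (λ t → f t + g t) + (f (suc n) + g (suc n))
      ≈⟨ +-congʳ (sumTo-+ n f g) ⟩
    (sumTo n f + sumTo n g) + (f (suc n) + g (suc n))
      ≈⟨ solve 4 (λ a b c d → (a :+ b) :+ (c :+ d) := (a :+ c) :+ (b :+ d)) refl _ _ _ _ ⟩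
    (sumTo n f + f (suc n)) + (sumTo n g + g (suc n)) ∎
    where
    open Solver
    open ≈-Reasoning

  sumTo-*ˡ : ∀ n a f → a * sumTo n f ≈ sumTo n (λ t → a * f t)
  sumTo-*ˡ zero    a f = refl
  sumTo-*ˡ (suc n) a f = trans (distribˡ _ _ _) (+-congʳ (sumTo-*ˡ n a f))

  sumTo-*ʳ : ∀ n a f → sumTo n f * a ≈ sumTo n (λ t → f t * a)
  sumTo-*ʳ zero    a f = refl
  sumTo-*ʳ (suc n) a f = trans (distribʳ _ _ _) (+-congʳ (sumTo-*ʳ n a f))

  sumTo-zero : ∀ n f → (∀ t → t ≤ n → f t ≈ 0#) → sumTo n f ≈ 0#
  sumTo-zero zero    f h = h 0 z≤n
  sumTo-zero (suc n) f h = trans (+-cong (sumTo-zero n f (λ t t≤n → h t (ℕP.m≤n⇒m≤1+n t≤n))) (h (suc n) ℕP.≤-refl))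
                                 (+-identityˡ 0#)

  sumTo-suc : ∀ n f → sumTo (suc n) f ≈ f 0 + sumTo n (λ t → f (suc t))
  sumTo-suc zero    f = refl
  sumTo-suc (suc n) f = trans (+-congʳ (sumTo-suc n f)) (+-assoc _ _ _)

  sumTo-reverse : ∀ n f → sumTo n f ≈ sumTo n (λ t → f (n ∸ t))
  sumTo-reverse zero    f = refl
  sumTo-reverse (suc n) f = begin
    sumTo (suc n) f
      ≈⟨ sumTo-suc n f ⟩
    f 0 + sumTo n (λ t → f (suc t))
      ≈⟨ +-congˡ (sumTo-reverse n (λ t → f (suc t))) ⟩
    f 0 + sumTo n (λ t → f (suc (n ∸ t)))
      ≈⟨ +-comm _ _ ⟩
    sumTo n (λ t → f (suc (n ∸ t))) + f 0
      ≈⟨ +-congʳ (sumTo-cong-≤ n (λ t t≤n → reflexive (P.cong f (P.sym (ℕP.+-∸-assoc 1 t≤n))))) ⟩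
    sumTo n (λ t → f (suc n ∸ t)) + f 0
      ≡⟨ P.cong (λ z → sumTo n (λ t → f (suc n ∸ t)) + f z) (P.sym (ℕP.n∸n≡0 n)) ⟩
    sumTo (suc n) (λ t → f (suc n ∸ t)) ∎
    where open ≈-Reasoning

  sumTo-triangle : ∀ n (F : ℕ → ℕ → Carrier) →
    sumTo n (λ i → sumTo i (λ j → F j (i ∸ j))) ≈ sumTo n (λ j → sumTo (n ∸ j) (F j))
  sumTo-triangle zero    F = refl
  sumTo-triangle (suc n) F = begin
    sumTo n (λ i → sumTo i (λ j → F j (i ∸ j))) + sumTo (suc n) (λ j → F j (suc n ∸ j))
      ≈⟨ +-congʳ (sumTo-triangle n F) ⟩
    sumTo n (λ j → sumTo (n ∸ j) (F j)) + (sumTo n (λ j → F j (suc n ∸ j)) + F (suc n) (n ∸ n))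
      ≈⟨ trans (sym (+-assoc _ _ _)) (+-congʳ (sym (sumTo-+ n _ _))) ⟩
    sumTo n (λ j → sumTo (n ∸ j) (F j) + F j (suc n ∸ j)) + F (suc n) (n ∸ n)
      ≈⟨ +-congʳ (sumTo-cong-≤ n extend) ⟩
    sumTo n (λ j → sumTo (suc n ∸ j) (F j)) + F (suc n) (n ∸ n)
      ≈⟨ +-congˡ (single-term (n ∸ n) (ℕP.n∸n≡0 n)) ⟩
    sumTo (suc n) (λ j → sumTo (suc n ∸ j) (F j)) ∎
    where
    open ≈-Reasoning
    extend : ∀ j → j ≤ n → sumTo (n ∸ j) (F j) + F j (suc n ∸ j) ≈ sumTo (suc n ∸ j) (F j)
    extend j j≤n rewrite ℕP.+-∸-assoc 1 j≤n = refl
    single-term : ∀ m → m ≡ 0 → F (suc n) m ≈ sumTo m (F (suc n))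
    single-term _ P.refl = refl

  sumTo-single : ∀ L g k → k ≤ L → (∀ t → t ≤ L → t ≢ k → g t ≈ 0#) → sumTo L g ≈ g k
  sumTo-single zero    g zero _ h = refl
  sumTo-single (suc L) g k k≤L h with k ℕP.≟ suc L
  ... | yes P.refl = trans (+-congʳ (sumTo-zero L g (λ t t≤L → h t (ℕP.m≤n⇒m≤1+n t≤L) (ℕP.<⇒≢ (s≤s t≤L)))))
                           (+-identityˡ _)
  ... | no k≢1+L   = trans (+-cong (sumTo-single L g k (ℕP.≤-pred (ℕP.≤∧≢⇒< k≤L k≢1+L))
                                                  (λ t t≤L → h t (ℕP.m≤n⇒m≤1+n t≤L)))
                                   (h (suc L) ℕP.≤-refl (λ e → k≢1+L (P.sym e))))
                           (+-identityʳ _)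

  sumTo-truncate : ∀ N k g → k ≤ N → (∀ t → k < t → t ≤ N → g t ≈ 0#) → sumTo N g ≈ sumTo k g
  sumTo-truncate N k g k≤N h with k ℕP.≟ N
  ... | yes P.refl = refl
  sumTo-truncate zero    k g k≤N h | no k≢N = ⊥-elim (k≢N (ℕP.n≤0⇒n≡0 k≤N))
  sumTo-truncate (suc N) k g k≤N h | no k≢N =
    trans (+-cong (sumTo-truncate N k g k≤N′ (λ t k<t t≤N → h t k<t (ℕP.m≤n⇒m≤1+n t≤N)))
                  (h (suc N) (s≤s k≤N′) ℕP.≤-refl))
          (+-identityʳ _)
    where
    k≤N′ : k ≤ N
    k≤N′ = ℕP.≤-pred (ℕP.≤∧≢⇒< k≤N k≢N)

  foldr-applyUpTo : ∀ m g → foldr _+_ 0# (applyUpTo g (suc m)) ≈ sumTo m g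
  foldr-applyUpTo zero    g = +-identityʳ _
  foldr-applyUpTo (suc m) g = trans (+-congˡ (foldr-applyUpTo m (λ i → g (suc i)))) (sym (sumTo-suc m g))

  sumFromTo≈sumTo : ∀ k m f → (∀ ν → ν < k → f ν ≈ 0#) → sumFromTo k m f ≈ sumTo m f
  sumFromTo≈sumTo k m f h = trans (drop-zeros k m f h) (foldr-applyUpTo m f)
    where
    drop-zeros : ∀ k m f → (∀ ν → ν < k → f ν ≈ 0#) →
      foldr _+_ 0# (applyUpTo (λ i → f (k ℕ.+ i)) (suc m ∸ k)) ≈ foldr _+_ 0# (applyUpTo f (suc m))
    drop-zeros zero    m       f h = refl
    drop-zeros (suc k) zero    f h rewrite ℕP.0∸n≡0 k = sym (trans (+-congʳ (h 0 (s≤s z≤n))) (+-identityˡ 0#))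
    drop-zeros (suc k) (suc m) f h = trans (drop-zeros k m (λ i → f (suc i)) (λ ν ν<k → h (suc ν) (s≤s ν<k)))
                                           (sym (trans (+-congʳ (h 0 (s≤s z≤n))) (+-identityˡ _)))

module PowerSeries {c ℓ} (R : CommutativeRing c ℓ) where
  open CommutativeRing R
  open Over R
  open Numerals R
  open FiniteSums R

  infix  4 _≐_
  infixl 6 _+S_

  _≐_ : FPS → FPS → Set ℓ
  f ≐ g = ∀ i → f i ≈ g i

  _+S_ : FPS → FPS → FPS
  (f +S g) i = f i + g i

  -S_ : FPS → FPS
  (-S f) i = - f i

  0S : FPS
  0S _ = 0#

  constS : Carrier → FPS
  constS a zero    = a
  constS a (suc _) = 0#

  1S : FPS
  1S = constS 1#

  X : FPS
  X zero    = 0#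
  X (suc i) = 1S i

  *S-cong : ∀ {f f′ g g′} → f ≐ f′ → g ≐ g′ → f *S g ≐ f′ *S g′
  *S-cong f≐f′ g≐g′ i = sumTo-cong i (λ t → *-cong (f≐f′ t) (g≐g′ (i ∸ t)))

  *S-comm : ∀ f g → f *S g ≐ g *S f
  *S-comm f g i = begin
    sumTo i (λ t → f t * g (i ∸ t))             ≈⟨ sumTo-reverse i _ ⟩
    sumTo i (λ t → f (i ∸ t) * g (i ∸ (i ∸ t))) ≈⟨ sumTo-cong-≤ i swap ⟩
    sumTo i (λ t → g t * f (i ∸ t))             ∎
    where
    open ≈-Reasoning
    swap : ∀ t → t ≤ i → f (i ∸ t) * g (i ∸ (i ∸ t)) ≈ g t * f (i ∸ t)
    swap t t≤i = trans (*-comm _ _) (reflexive (P.cong (λ z → g z * f (i ∸ t)) (ℕP.m∸[m∸n]≡n t≤i)))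

  *S-assoc : ∀ f g h → (f *S g) *S h ≐ f *S (g *S h)
  *S-assoc f g h n = begin
    sumTo n (λ i → sumTo i (λ j → f j * g (i ∸ j)) * h (n ∸ i))
      ≈⟨ sumTo-cong n (λ i → sumTo-*ʳ i _ _) ⟩
    sumTo n (λ i → sumTo i (λ j → f j * g (i ∸ j) * h (n ∸ i)))
      ≈⟨ sumTo-cong-≤ n (λ i i≤n → sumTo-cong-≤ i (λ j j≤i → reindex i j i≤n j≤i)) ⟩
    sumTo n (λ i → sumTo i (λ j → F j (i ∸ j)))
      ≈⟨ sumTo-triangle n F ⟩
    sumTo n (λ j → sumTo (n ∸ j) (F j))
      ≈⟨ sumTo-cong n (λ j → sym (sumTo-*ˡ (n ∸ j) _ _)) ⟩
    sumTo n (λ j → f j * (g *S h) (n ∸ j)) ∎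
    where
    open ≈-Reasoning
    F : ℕ → ℕ → Carrier
    F j k = f j * (g k * h (n ∸ j ∸ k))
    reindex : ∀ i j → i ≤ n → j ≤ i → f j * g (i ∸ j) * h (n ∸ i) ≈ F j (i ∸ j)
    reindex i j i≤n j≤i = trans (*-assoc _ _ _) (reflexive (P.cong (λ z → f j * (g (i ∸ j) * h z)) n∸i≡n∸j∸[i∸j]))
      where
      n∸i≡n∸j∸[i∸j] : n ∸ i ≡ n ∸ j ∸ (i ∸ j)
      n∸i≡n∸j∸[i∸j] = P.trans (P.cong (n ∸_) (P.sym (ℕP.m+[n∸m]≡n j≤i))) (P.sym (ℕP.∸-+-assoc n j (i ∸ j)))

  constS-*S : ∀ a s i → (constS a *S s) i ≈ a * s i
  constS-*S a s zero    = refl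
  constS-*S a s (suc i) = begin
    sumTo (suc i) (λ t → constS a t * s (suc i ∸ t))  ≈⟨ sumTo-suc i _ ⟩
    a * s (suc i) + sumTo i (λ t → 0# * s (i ∸ t))    ≈⟨ +-congˡ (sumTo-zero i _ (λ t _ → zeroˡ _)) ⟩
    a * s (suc i) + 0#                                ≈⟨ +-identityʳ _ ⟩
    a * s (suc i)                                     ∎
    where open ≈-Reasoning

  *S-identityˡ : ∀ g → 1S *S g ≐ g
  *S-identityˡ g i = trans (constS-*S 1# g i) (*-identityˡ _)

  *S-distribʳ : ∀ f g h → (g +S h) *S f ≐ g *S f +S h *S f
  *S-distribʳ f g h i = trans (sumTo-cong i (λ t → distribʳ _ _ _)) (sumTo-+ i _ _)

  FPS-commutativeRing : CommutativeRing c ℓ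
  FPS-commutativeRing = record
    { Carrier = FPS
    ; _≈_ = _≐_
    ; _+_ = _+S_
    ; _*_ = _*S_
    ; -_ = -S_
    ; 0# = 0S
    ; 1# = 1S
    ; isCommutativeRing = record
      { isRing = record
        { +-isAbelianGroup = record
          { isGroup = record
            { isMonoid = record
              { isSemigroup = record
                { isMagma = record
                  { isEquivalence = record
                    { refl  = λ i → refl
                    ; sym   = λ p i → sym (p i)
                    ; trans = λ p q i → trans (p i) (q i) }
                  ; ∙-cong = λ p q i → +-cong (p i) (q i) }
                ; assoc = λ f g h i → +-assoc (f i) (g i) (h i) }
              ; identity = (λ f i → +-identityˡ (f i)) , (λ f i → +-identityʳ (f i)) }
            ; inverse = (λ f i → -‿inverseˡ (f i)) , (λ f i → -‿inverseʳ (f i))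
            ; ⁻¹-cong = λ p i → -‿cong (p i) }
          ; comm = λ f g i → +-comm (f i) (g i) }
        ; *-cong = *S-cong
        ; *-assoc = *S-assoc
        ; *-identity = *S-identityˡ , (λ g i → trans (*S-comm g 1S i) (*S-identityˡ g i))
        ; distrib = (λ f g h i → trans (*S-comm f (g +S h) i) (trans (*S-distribʳ f g h i)
                      (+-cong (*S-comm g f i) (*S-comm h f i))))
                  , *S-distribʳ }
      ; *-comm = *S-comm }
    }

  *S-congˡ : ∀ h {f g} → f ≐ g → h *S f ≐ h *S g
  *S-congˡ h f≐g = *S-cong {h} {h} (λ i → refl) f≐g

  *S-congʳ : ∀ h {f g} → f ≐ g → f *S h ≐ g *S h
  *S-congʳ h f≐g = *S-cong {g = h} {g′ = h} f≐g (λ i → refl)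

  module S  = CommutativeRing FPS-commutativeRing
  module OS = Over FPS-commutativeRing
  module NS = Numerals FPS-commutativeRing
  module FS = FiniteSums FPS-commutativeRing
  module ≐-Reasoning = SetoidReasoning S.setoid

  X*S-zero : ∀ s → (X *S s) 0 ≈ 0#
  X*S-zero s = zeroˡ _

  X*S-suc : ∀ s i → (X *S s) (suc i) ≈ s i
  X*S-suc s i = begin
    (X *S s) (suc i)                                        ≈⟨ sumTo-suc i _ ⟩
    0# * s (suc i) + sumTo i (λ t → X (suc t) * s (i ∸ t))  ≈⟨ +-cong (zeroˡ _) (constS-*S 1# s i) ⟩
    0# + 1# * s i                                           ≈⟨ trans (+-identityˡ _) (*-identityˡ _) ⟩
    s i                                                     ∎
    where open ≈-Reasoning

  X-cancel : ∀ s t → X *S s ≐ X *S t → s ≐ t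
  X-cancel s t h i = trans (sym (X*S-suc s i)) (trans (h (suc i)) (X*S-suc t i))

  X^j*S-≤ : ∀ j s i → j ≤ i → (OS.pow X j *S s) i ≈ s (i ∸ j)
  X^j*S-≤ zero    s i       _         = *S-identityˡ s i
  X^j*S-≤ (suc j) s (suc i) (s≤s j≤i) = trans (*S-assoc X (OS.pow X j) s (suc i))
    (trans (X*S-suc (OS.pow X j *S s) i) (X^j*S-≤ j s i j≤i))

  X^j*S-< : ∀ j s i → i < j → (OS.pow X j *S s) i ≈ 0#
  X^j*S-< (suc j) s zero    _         = trans (*S-assoc X (OS.pow X j) s 0) (X*S-zero (OS.pow X j *S s))
  X^j*S-< (suc j) s (suc i) (s≤s i<j) = trans (*S-assoc X (OS.pow X j) s (suc i))
    (trans (X*S-suc (OS.pow X j *S s) i) (X^j*S-< j s i i<j))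

  sumToS-coeff : ∀ n (F : ℕ → FPS) i → OS.sumTo n F i ≈ sumTo n (λ μ → F μ i)
  sumToS-coeff zero    F i = refl
  sumToS-coeff (suc n) F i = +-congʳ (sumToS-coeff n F i)

  constS-cong : ∀ {a b} → a ≈ b → constS a ≐ constS b
  constS-cong a≈b zero    = a≈b
  constS-cong a≈b (suc i) = refl

  constS-+ : ∀ a b → constS (a + b) ≐ constS a +S constS b
  constS-+ a b zero    = refl
  constS-+ a b (suc i) = sym (+-identityʳ 0#)

  constS-* : ∀ a b → constS (a * b) ≐ constS a *S constS b
  constS-* a b i = sym (trans (constS-*S a (constS b) i) (pointwise i))
    where
    pointwise : ∀ i → a * constS b i ≈ constS (a * b) i
    pointwise zero    = refl
    pointwise (suc i) = zeroʳ a

  constS-0 : constS 0# ≐ 0S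
  constS-0 zero    = refl
  constS-0 (suc i) = refl

  constS-neg : ∀ a → constS (- a) ≐ -S constS a
  constS-neg a zero    = refl
  constS-neg a (suc i) = sym -0#≈0#

  constS-fromℕ : ∀ m → constS (fromℕ m) ≐ OS.fromℕ m
  constS-fromℕ zero    = constS-0
  constS-fromℕ (suc m) = S.trans (constS-+ 1# (fromℕ m)) (S.+-congˡ (constS-fromℕ m))

  linear : Carrier → Carrier → FPS
  linear a b = constS a +S constS b *S X

  linear-*S : ∀ a b s i → (linear a b *S s) i ≈ a * s i + b * (X *S s) i
  linear-*S a b s i = trans (*S-distribʳ s (constS a) (constS b *S X) i)
    (+-cong (constS-*S a s i) (trans (*S-assoc (constS b) X s i) (constS-*S b (X *S s) i)))

  linear-cancel : ∀ a a⁻¹ b → a⁻¹ * a ≈ 1# → ∀ s t → linear a b *S s ≐ linear a b *S t → s ≐ t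
  linear-cancel a a⁻¹ b a⁻¹a≈1 s t h = go
    where
    open ≈-Reasoning
    cancel-a : ∀ {x y} → a * x ≈ a * y → x ≈ y
    cancel-a {x} {y} e = begin
      x              ≈⟨ sym (trans (*-congʳ a⁻¹a≈1) (*-identityˡ x)) ⟩
      (a⁻¹ * a) * x  ≈⟨ trans (*-assoc _ _ _) (*-congˡ e) ⟩
      a⁻¹ * (a * y)  ≈⟨ trans (sym (*-assoc _ _ _)) (trans (*-congʳ a⁻¹a≈1) (*-identityˡ y)) ⟩
      y              ∎
    go : s ≐ t
    go zero = cancel-a (begin
      a * s 0                   ≈⟨ sym (trans (+-congˡ (trans (*-congˡ (X*S-zero s)) (zeroʳ b))) (+-identityʳ _)) ⟩
      a * s 0 + b * (X *S s) 0  ≈⟨ trans (sym (linear-*S a b s 0)) (trans (h 0) (linear-*S a b t 0)) ⟩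
      a * t 0 + b * (X *S t) 0  ≈⟨ trans (+-congˡ (trans (*-congˡ (X*S-zero t)) (zeroʳ b))) (+-identityʳ _) ⟩
      a * t 0                   ∎)
    go (suc i) = cancel-a (+-cancelʳ (b * s i) _ _ (begin
      a * s (suc i) + b * s i
        ≈⟨ +-congˡ (*-congˡ (sym (X*S-suc s i))) ⟩
      a * s (suc i) + b * (X *S s) (suc i)
        ≈⟨ trans (sym (linear-*S a b s (suc i))) (trans (h (suc i)) (linear-*S a b t (suc i))) ⟩
      a * t (suc i) + b * (X *S t) (suc i)
        ≈⟨ +-congˡ (*-congˡ (trans (X*S-suc t i) (sym (go i)))) ⟩
      a * t (suc i) + b * s i ∎))

  HasDegree≤ : ℕ → FPS → Set ℓ
  HasDegree≤ m s = ∀ i → m < i → s i ≈ 0#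

  HasDegree≤-mono : ∀ {m m′} s → m ≤ m′ → HasDegree≤ m s → HasDegree≤ m′ s
  HasDegree≤-mono s m≤m′ deg i m′<i = deg i (ℕP.≤-<-trans m≤m′ m′<i)

  constS-degree : ∀ a → HasDegree≤ 0 (constS a)
  constS-degree a (suc i) _ = refl

  +S-degree : ∀ m s t → HasDegree≤ m s → HasDegree≤ m t → HasDegree≤ m (s +S t)
  +S-degree m s t ds dt i m<i = trans (+-cong (ds i m<i) (dt i m<i)) (+-identityʳ 0#)

  *S-degree : ∀ a b s t → HasDegree≤ a s → HasDegree≤ b t → HasDegree≤ (a ℕ.+ b) (s *S t)
  *S-degree a b s t ds dt i a+b<i = sumTo-zero i _ term-vanishes
    where
    term-vanishes : ∀ j → j ≤ i → s j * t (i ∸ j) ≈ 0#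
    term-vanishes j j≤i with a ℕP.<? j
    ... | yes a<j = trans (*-congʳ (ds j a<j)) (zeroˡ _)
    ... | no a≮j  = trans (*-congˡ (dt (i ∸ j) b<i∸j)) (zeroʳ _)
      where
      b<i∸j : b < i ∸ j
      b<i∸j = ℕP.+-cancelˡ-< j b (i ∸ j) (ℕP.<-≤-trans (ℕP.≤-<-trans (ℕP.+-monoˡ-≤ b (ℕP.≮⇒≥ a≮j)) a+b<i)
                                                    (ℕP.≤-reflexive (P.sym (ℕP.m+[n∸m]≡n j≤i))))

  *S-top-coeff : ∀ a b s t → HasDegree≤ a s → HasDegree≤ b t → (s *S t) (a ℕ.+ b) ≈ s a * t b
  *S-top-coeff a b s t ds dt = trans (sumTo-single (a ℕ.+ b) _ a (ℕP.m≤m+n a b) off-diagonal)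
                                     (*-congˡ (reflexive (P.cong t (ℕP.m+n∸m≡n a b))))
    where
    off-diagonal : ∀ j → j ≤ a ℕ.+ b → j ≢ a → s j * t (a ℕ.+ b ∸ j) ≈ 0#
    off-diagonal j _ j≢a with ℕP.<-cmp j a
    ... | tri< j<a _ _ = trans (*-congˡ (dt _ b<a+b∸j)) (zeroʳ _)
      where
      b<a+b∸j : b < a ℕ.+ b ∸ j
      b<a+b∸j = P.subst (b <_) (P.sym (ℕP.+-∸-comm b (ℕP.<⇒≤ j<a))) (ℕP.m<n+m b (ℕP.n≢0⇒n>0 (ℕP.m>n⇒m∸n≢0 j<a)))
    ... | tri≈ _ j≡a _ = ⊥-elim (j≢a j≡a)
    ... | tri> _ _ a<j = trans (*-congʳ (ds j a<j)) (zeroˡ _)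

module Polynomials {c ℓ} (R : CommutativeRing c ℓ) where
  open CommutativeRing R
  open Over R
  open Numerals R

  coeff-+P : ∀ p q i → coeff (p +P q) i ≈ coeff p i + coeff q i
  coeff-+P []      q       i       = sym (+-identityˡ _)
  coeff-+P (a ∷ p) []      i       = sym (+-identityʳ _)
  coeff-+P (a ∷ p) (b ∷ q) zero    = refl
  coeff-+P (a ∷ p) (b ∷ q) (suc i) = coeff-+P p q i

  coeff-scaleP : ∀ a p i → coeff (scaleP a p) i ≈ a * coeff p i
  coeff-scaleP a []      i       = sym (zeroʳ a)
  coeff-scaleP a (b ∷ p) zero    = refl
  coeff-scaleP a (b ∷ p) (suc i) = coeff-scaleP a p i

  coeff-applyUpTo-< : ∀ f m i → i < m → coeff (applyUpTo f m) i ≡ f i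
  coeff-applyUpTo-< f (suc m) zero    _         = P.refl
  coeff-applyUpTo-< f (suc m) (suc i) (s≤s i<m) = coeff-applyUpTo-< (λ j → f (suc j)) m i i<m

  coeff-applyUpTo-≥ : ∀ f m i → m ≤ i → coeff (applyUpTo f m) i ≡ 0#
  coeff-applyUpTo-≥ f zero    i       _         = P.refl
  coeff-applyUpTo-≥ f (suc m) (suc i) (s≤s m≤i) = coeff-applyUpTo-≥ (λ j → f (suc j)) m i m≤i

  coeff-≥length : ∀ p j → length p ≤ j → coeff p j ≡ 0#
  coeff-≥length []      j       _         = P.refl
  coeff-≥length (a ∷ p) (suc j) (s≤s l≤j) = coeff-≥length p j l≤j

  -- (a + x p)′ = p + x p′
  derivP : Poly → Poly
  derivP []      = []
  derivP (a ∷ p) = p +P (0# ∷ derivP p)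

  coeff-derivP : ∀ p i → coeff (derivP p) i ≈ fromℕ (suc i) * coeff p (suc i)
  coeff-derivP []      i       = sym (zeroʳ _)
  coeff-derivP (a ∷ p) zero    = trans (coeff-+P p (0# ∷ derivP p) 0)
    (trans (+-identityʳ _) (sym (trans (*-congʳ (+-identityʳ 1#)) (*-identityˡ _))))
  coeff-derivP (a ∷ p) (suc i) = trans (coeff-+P p (0# ∷ derivP p) (suc i))
    (trans (+-congˡ (coeff-derivP p i)) (sym (trans (distribʳ _ _ _) (+-congʳ (*-identityˡ _)))))

  derivP-+P : ∀ p q → derivP (p +P q) ≋ derivP p +P derivP q
  derivP-+P p q i = trans (coeff-derivP (p +P q) i) (trans (*-congˡ (coeff-+P p q (suc i)))
    (trans (distribˡ _ _ _) (sym (trans (coeff-+P (derivP p) (derivP q) i) (+-cong (coeff-derivP p i) (coeff-derivP q i))))))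

  derivP-scaleP : ∀ a p → derivP (scaleP a p) ≋ scaleP a (derivP p)
  derivP-scaleP a p i = trans (coeff-derivP (scaleP a p) i) (trans (*-congˡ (coeff-scaleP a p (suc i)))
    (trans (x∙yz≈y∙xz _ _ _) (sym (trans (coeff-scaleP a (derivP p) i) (*-congˡ (coeff-derivP p i))))))
    where open CommSemigroupProperties *-commutativeSemigroup using (x∙yz≈y∙xz)

module Evaluation {c ℓ c′ ℓ′} (R : CommutativeRing c ℓ) (S : CommutativeRing c′ ℓ′)
  (ι : CommutativeRing.Carrier R → CommutativeRing.Carrier S)
  (ι-cong : ∀ {a b} → CommutativeRing._≈_ R a b → CommutativeRing._≈_ S (ι a) (ι b))
  (ι-+ : ∀ a b → CommutativeRing._≈_ S (ι (CommutativeRing._+_ R a b)) (CommutativeRing._+_ S (ι a) (ι b)))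
  (ι-* : ∀ a b → CommutativeRing._≈_ S (ι (CommutativeRing._*_ R a b)) (CommutativeRing._*_ S (ι a) (ι b)))
  (ι-0 : CommutativeRing._≈_ S (ι (CommutativeRing.0# R)) (CommutativeRing.0# S))
  where
  private
    module R = CommutativeRing R
  open CommutativeRing S
  open Over S using (pow; sumTo)
  open Over R using (Poly; coeff; _≋_; _+P_; scaleP; _*P_; _∘P_)
  open Polynomials R using (derivP; derivP-+P; derivP-scaleP)
  open Numerals S
  open FiniteSums S
  open Solver

  ev : Poly → Carrier → Carrier
  ev []      z = 0#
  ev (a ∷ p) z = ι a + z * ev p z

  ev-+P : ∀ p q z → ev (p +P q) z ≈ ev p z + ev q z
  ev-+P []      q       z = sym (+-identityˡ _)
  ev-+P (a ∷ p) []      z = sym (+-identityʳ _)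
  ev-+P (a ∷ p) (b ∷ q) z = begin
    ι (a R.+ b) + z * ev (p +P q) z
      ≈⟨ +-cong (ι-+ a b) (*-congˡ (ev-+P p q z)) ⟩
    (ι a + ι b) + z * (ev p z + ev q z)
      ≈⟨ solve 5 (λ A B Z P Q → (A :+ B) :+ Z :* (P :+ Q) := (A :+ Z :* P) :+ (B :+ Z :* Q)) refl _ _ _ _ _ ⟩
    (ι a + z * ev p z) + (ι b + z * ev q z) ∎
    where open ≈-Reasoning

  ev-scaleP : ∀ a p z → ev (scaleP a p) z ≈ ι a * ev p z
  ev-scaleP a []      z = sym (zeroʳ _)
  ev-scaleP a (b ∷ p) z = begin
    ι (a R.* b) + z * ev (scaleP a p) z ≈⟨ +-cong (ι-* a b) (*-congˡ (ev-scaleP a p z)) ⟩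
    ι a * ι b + z * (ι a * ev p z)      ≈⟨ solve 4 (λ A B Z P → A :* B :+ Z :* (A :* P) := A :* (B :+ Z :* P)) refl _ _ _ _ ⟩
    ι a * (ι b + z * ev p z)            ∎
    where open ≈-Reasoning

  ev-*P : ∀ p q z → ev (p *P q) z ≈ ev p z * ev q z
  ev-*P []      q z = sym (zeroˡ _)
  ev-*P (a ∷ p) q z = begin
    ev (scaleP a q +P (R.0# ∷ (p *P q))) z
      ≈⟨ ev-+P (scaleP a q) _ z ⟩
    ev (scaleP a q) z + (ι R.0# + z * ev (p *P q) z)
      ≈⟨ +-cong (ev-scaleP a q z) (+-cong ι-0 (*-congˡ (ev-*P p q z))) ⟩
    ι a * ev q z + (0# + z * (ev p z * ev q z))
      ≈⟨ solve 4 (λ A Q Z P → A :* Q :+ (con (+ 0) :+ Z :* (P :* Q)) := (A :+ Z :* P) :* Q) refl _ _ _ _ ⟩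
    (ι a + z * ev p z) * ev q z ∎
    where open ≈-Reasoning

  ev-∘P : ∀ p q z → ev (p ∘P q) z ≈ ev p (ev q z)
  ev-∘P []      q z = refl
  ev-∘P (a ∷ p) q z = begin
    ev ((a ∷ []) +P (q *P (p ∘P q))) z       ≈⟨ ev-+P (a ∷ []) (q *P (p ∘P q)) z ⟩
    (ι a + z * 0#) + ev (q *P (p ∘P q)) z    ≈⟨ +-cong (trans (+-congˡ (zeroʳ z)) (+-identityʳ _)) (ev-*P q _ z) ⟩
    ι a + ev q z * ev (p ∘P q) z             ≈⟨ +-congˡ (*-congˡ (ev-∘P p q z)) ⟩
    ι a + ev q z * ev p (ev q z)             ∎
    where open ≈-Reasoning

  ev-zero : ∀ p z → (∀ i → coeff p i R.≈ R.0#) → ev p z ≈ 0#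
  ev-zero []      z h = refl
  ev-zero (a ∷ p) z h = trans (+-cong (trans (ι-cong (h 0)) ι-0) (*-congˡ (ev-zero p z (λ i → h (suc i)))))
                              (trans (+-identityˡ _) (zeroʳ z))

  ev-cong : ∀ p q z → p ≋ q → ev p z ≈ ev q z
  ev-cong []      q       z h = sym (ev-zero q z (λ i → R.sym (h i)))
  ev-cong (a ∷ p) []      z h = ev-zero (a ∷ p) z h
  ev-cong (a ∷ p) (b ∷ q) z h = +-cong (ι-cong (h 0)) (*-congˡ (ev-cong p q z (λ i → h (suc i))))

  ev-congʳ : ∀ p {z w} → z ≈ w → ev p z ≈ ev p w
  ev-congʳ []      z≈w = refl
  ev-congʳ (a ∷ p) z≈w = +-congˡ (*-cong z≈w (ev-congʳ p z≈w))

  ev-applyUpTo : ∀ n f z → ev (applyUpTo f (suc n)) z ≈ sumTo n (λ μ → ι (f μ) * pow z μ)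
  ev-applyUpTo zero    f z = trans (+-congˡ (zeroʳ z)) (trans (+-identityʳ _) (sym (*-identityʳ _)))
  ev-applyUpTo (suc n) f z = begin
    ι (f 0) + z * ev (applyUpTo (λ i → f (suc i)) (suc n)) z
      ≈⟨ +-cong (sym (*-identityʳ _)) (*-congˡ (ev-applyUpTo n (λ i → f (suc i)) z)) ⟩
    ι (f 0) * 1# + z * sumTo n (λ μ → ι (f (suc μ)) * pow z μ)
      ≈⟨ +-congˡ (trans (sumTo-*ˡ n z _) (sumTo-cong n (λ μ → x∙yz≈y∙xz z _ _))) ⟩
    ι (f 0) * 1# + sumTo n (λ μ → ι (f (suc μ)) * (z * pow z μ))
      ≈⟨ sym (sumTo-suc n _) ⟩
    sumTo (suc n) (λ μ → ι (f μ) * pow z μ) ∎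
    where
    open CommSemigroupProperties *-commutativeSemigroup using (x∙yz≈y∙xz)
    open ≈-Reasoning

  mutual
    evenPart : Poly → Poly
    evenPart []      = []
    evenPart (a ∷ p) = a ∷ oddPart p

    oddPart : Poly → Poly
    oddPart []      = []
    oddPart (a ∷ p) = evenPart p

  mutual
    coeff-evenPart : ∀ p j → coeff (evenPart p) j ≡ coeff p (j ℕ.+ j)
    coeff-evenPart []      j       = P.refl
    coeff-evenPart (a ∷ p) zero    = P.refl
    coeff-evenPart (a ∷ p) (suc j) = P.trans (coeff-oddPart p j) (P.cong (coeff p) (P.sym (ℕP.+-suc j j)))

    coeff-oddPart : ∀ p j → coeff (oddPart p) j ≡ coeff p (suc (j ℕ.+ j))
    coeff-oddPart []      j = P.refl
    coeff-oddPart (a ∷ p) j = coeff-evenPart p j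

  ev-evenPart-oddPart : ∀ p y → ev p y ≈ ev (evenPart p) (y * y) + y * ev (oddPart p) (y * y)
  ev-evenPart-oddPart []      y = sym (trans (+-identityˡ _) (zeroʳ y))
  ev-evenPart-oddPart (a ∷ p) y = begin
    ι a + y * ev p y
      ≈⟨ +-congˡ (*-congˡ (ev-evenPart-oddPart p y)) ⟩
    ι a + y * (ev (evenPart p) (y * y) + y * ev (oddPart p) (y * y))
      ≈⟨ solve 4 (λ A Y E O → A :+ Y :* (E :+ Y :* O) := (A :+ (Y :* Y) :* O) :+ Y :* E) refl _ _ _ _ ⟩
    (ι a + (y * y) * ev (oddPart p) (y * y)) + y * ev (evenPart p) (y * y) ∎
    where open ≈-Reasoning

  ev-derivP-∷ : ∀ a p z → ev (derivP (a ∷ p)) z ≈ ev p z + z * ev (derivP p) z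
  ev-derivP-∷ a p z = trans (ev-+P p (R.0# ∷ derivP p) z) (+-congˡ (trans (+-congʳ ι-0) (+-identityˡ _)))

  ev-derivP-+P : ∀ p q z → ev (derivP (p +P q)) z ≈ ev (derivP p) z + ev (derivP q) z
  ev-derivP-+P p q z = trans (ev-cong (derivP (p +P q)) (derivP p +P derivP q) z (derivP-+P p q))
                             (ev-+P (derivP p) (derivP q) z)

  ev-derivP-scaleP : ∀ a p z → ev (derivP (scaleP a p)) z ≈ ι a * ev (derivP p) z
  ev-derivP-scaleP a p z = trans (ev-cong (derivP (scaleP a p)) (scaleP a (derivP p)) z (derivP-scaleP a p))
                                 (ev-scaleP a (derivP p) z)

  ev-derivP-*P : ∀ r s z → ev (derivP (r *P s)) z ≈ ev (derivP r) z * ev s z + ev r z * ev (derivP s) z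
  ev-derivP-*P []      s z = sym (trans (+-cong (zeroˡ _) (zeroˡ _)) (+-identityˡ 0#))
  ev-derivP-*P (a ∷ r) s z = begin
    ev (derivP (scaleP a s +P (R.0# ∷ (r *P s)))) z
      ≈⟨ ev-derivP-+P (scaleP a s) (R.0# ∷ (r *P s)) z ⟩
    ev (derivP (scaleP a s)) z + ev (derivP (R.0# ∷ (r *P s))) z
      ≈⟨ +-cong (ev-derivP-scaleP a s z) (ev-derivP-∷ R.0# (r *P s) z) ⟩
    ι a * ds + (ev (r *P s) z + z * ev (derivP (r *P s)) z)
      ≈⟨ +-congˡ (+-cong (ev-*P r s z) (*-congˡ (ev-derivP-*P r s z))) ⟩
    ι a * ds + (er * es + z * (dr * es + er * ds))
      ≈⟨ solve 6 (λ A DS ER ES DR Z → A :* DS :+ (ER :* ES :+ Z :* (DR :* ES :+ ER :* DS))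
                                    := (ER :+ Z :* DR) :* ES :+ (A :+ Z :* ER) :* DS) refl _ _ _ _ _ _ ⟩
    (er + z * dr) * es + (ι a + z * er) * ds
      ≈⟨ +-congʳ (*-congʳ (sym (ev-derivP-∷ a r z))) ⟩
    ev (derivP (a ∷ r)) z * es + ev (a ∷ r) z * ds ∎
    where
    open ≈-Reasoning
    er es dr ds : Carrier
    er = ev r z
    es = ev s z
    dr = ev (derivP r) z
    ds = ev (derivP s) z

  ev-derivP-∘P : ∀ p q z → ev (derivP (p ∘P q)) z ≈ ev (derivP q) z * ev (derivP p) (ev q z)
  ev-derivP-∘P []      q z = sym (zeroʳ _)
  ev-derivP-∘P (a ∷ p) q z = begin
    ev (derivP ((a ∷ []) +P (q *P (p ∘P q)))) z
      ≈⟨ ev-derivP-+P (a ∷ []) (q *P (p ∘P q)) z ⟩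
    ev (derivP (a ∷ [])) z + ev (derivP (q *P (p ∘P q))) z
      ≈⟨ +-cong (trans (ev-derivP-∷ a [] z) (trans (+-identityˡ _) (zeroʳ z))) (ev-derivP-*P q (p ∘P q) z) ⟩
    0# + (dq * ev (p ∘P q) z + y * ev (derivP (p ∘P q)) z)
      ≈⟨ +-congˡ (+-cong (*-congˡ (ev-∘P p q z)) (*-congˡ (ev-derivP-∘P p q z))) ⟩
    0# + (dq * ev p y + y * (dq * ev (derivP p) y))
      ≈⟨ solve 4 (λ DQ P Y DP → con (+ 0) :+ (DQ :* P :+ Y :* (DQ :* DP)) := DQ :* (P :+ Y :* DP)) refl _ _ _ _ ⟩
    dq * (ev p y + y * ev (derivP p) y)
      ≈⟨ *-congˡ (sym (ev-derivP-∷ a p y)) ⟩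
    dq * ev (derivP (a ∷ p)) y ∎
    where
    open ≈-Reasoning
    y dq : Carrier
    y  = ev q z
    dq = ev (derivP q) z

module BinomialCoefficients where
  open P.≡-Reasoning
  open +-*-Solver

  absorption : ∀ m k → suc k ℕ.* (suc m C suc k) ≡ suc m ℕ.* (m C k)
  absorption zero    zero    = P.refl
  absorption zero    (suc k) = P.trans (ℕP.*-zeroʳ (suc (suc k))) (P.sym (ℕP.*-zeroʳ 1))
  absorption (suc m) zero    = P.trans (ℕP.*-identityˡ _) (P.trans (nC1≡n (suc (suc m))) (P.sym (ℕP.*-identityʳ _)))
  absorption (suc m) (suc k) = begin
    suc (suc k) ℕ.* (suc (suc m) C suc (suc k))
      ≡⟨ P.cong (suc (suc k) ℕ.*_) (P.sym (nCk+nC[k+1]≡[n+1]C[k+1] (suc m) (suc k))) ⟩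
    suc (suc k) ℕ.* (a ℕ.+ b)
      ≡⟨ solve 3 (λ K A B → (con 2 :+ K) :* (A :+ B) := A :+ (con 1 :+ K) :* A :+ (con 2 :+ K) :* B) P.refl k a b ⟩
    a ℕ.+ suc k ℕ.* a ℕ.+ suc (suc k) ℕ.* b
      ≡⟨ P.cong₂ (λ x y → a ℕ.+ x ℕ.+ y) (absorption m k) (absorption m (suc k)) ⟩
    a ℕ.+ suc m ℕ.* (m C k) ℕ.+ suc m ℕ.* (m C suc k)
      ≡⟨ P.trans (ℕP.+-assoc a _ _) (P.cong (a ℕ.+_) (P.sym (ℕP.*-distribˡ-+ (suc m) (m C k) (m C suc k)))) ⟩
    a ℕ.+ suc m ℕ.* (m C k ℕ.+ m C suc k)
      ≡⟨ P.cong (λ x → a ℕ.+ suc m ℕ.* x) (nCk+nC[k+1]≡[n+1]C[k+1] m k) ⟩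
    a ℕ.+ suc m ℕ.* a ∎
    where
    a b : ℕ
    a = suc m C suc k
    b = suc m C suc (suc k)

  absorption-shifted : ∀ m k → suc k ℕ.* ((m ℕ.+ suc k) C suc k) ≡ suc m ℕ.* ((suc m ℕ.+ k) C k)
  absorption-shifted m k = begin
    suc k ℕ.* ((m ℕ.+ suc k) C suc k)
      ≡⟨ P.cong (λ z → suc k ℕ.* (z C suc k)) (ℕP.+-suc m k) ⟩
    suc k ℕ.* (suc N C suc k)
      ≡⟨ absorption N k ⟩
    suc N ℕ.* (N C k)
      ≡⟨ P.cong (suc N ℕ.*_) (P.trans (nCk≡nC[n∸k] k≤N) (P.cong (N C_) (ℕP.m+n∸n≡m m k))) ⟩
    suc N ℕ.* (N C m)
      ≡⟨ P.sym (absorption N m) ⟩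
    suc m ℕ.* (suc N C suc m)
      ≡⟨ P.cong (suc m ℕ.*_) (P.sym (P.trans (nCk≡nC[n∸k] (ℕP.m≤n⇒m≤1+n k≤N)) (P.cong (suc N C_) 1+N∸k≡1+m))) ⟩
    suc m ℕ.* (suc N C k) ∎
    where
    N : ℕ
    N = m ℕ.+ k
    k≤N : k ≤ N
    k≤N = ℕP.m≤n+m k m
    1+N∸k≡1+m : suc N ∸ k ≡ suc m
    1+N∸k≡1+m = P.trans (ℕP.+-∸-assoc 1 k≤N) (P.cong suc (ℕP.m+n∸n≡m m k))

module BinomialSeries {c ℓ} (R : CommutativeRing c ℓ) where
  open CommutativeRing R
  open Over R
  open Numerals R
  open FiniteSums R
  open PowerSeries R

  binomSeries-neg : ∀ m ν → binomSeries -[1+ m ] ν ≈ sgn ν * fromℕ ((m ℕ.+ ν) C ν)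
  binomSeries-neg m ν = trans (fromℤ-* ((ℤ.- + 1) ℤ.^ ν) (+ ((m ℕ.+ ν) C ν))) (*-congʳ (fromℤ-[-1]^ ν))

  binomSeries-coeff-0 : ∀ e → binomSeries e 0 ≈ 1#
  binomSeries-coeff-0 (+ m)    = +-identityʳ 1#
  binomSeries-coeff-0 -[1+ m ] = +-identityʳ 1#

  binomSeries-+0 : binomSeries (+ 0) ≐ 1S
  binomSeries-+0 zero    = +-identityʳ 1#
  binomSeries-+0 (suc ν) = refl

  1+X : FPS
  1+X = linear 1# 1#

  1+X*S-zero : ∀ s → (1+X *S s) 0 ≈ s 0
  1+X*S-zero s = trans (linear-*S 1# 1# s 0) (trans (+-cong (*-identityˡ _) (*-congˡ (X*S-zero s)))
                   (trans (+-congˡ (zeroʳ 1#)) (+-identityʳ _)))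

  1+X*S-suc : ∀ s i → (1+X *S s) (suc i) ≈ s (suc i) + s i
  1+X*S-suc s i = trans (linear-*S 1# 1# s (suc i)) (+-cong (*-identityˡ _) (trans (*-identityˡ _) (X*S-suc s i)))

  pascal : ∀ e ν → binomSeries (e ℤ.+ + 1) (suc ν) ≈ binomSeries e (suc ν) + binomSeries e ν
  pascal (+ m) ν = begin
    fromℕ ((m ℕ.+ 1) C suc ν)             ≡⟨ P.cong (λ z → fromℕ (z C suc ν)) (ℕP.+-comm m 1) ⟩
    fromℕ (suc m C suc ν)                 ≡⟨ P.cong fromℕ (P.sym (nCk+nC[k+1]≡[n+1]C[k+1] m ν)) ⟩
    fromℕ (m C ν ℕ.+ m C suc ν)           ≈⟨ trans (fromℕ-+ (m C ν) (m C suc ν)) (+-comm _ _) ⟩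
    fromℕ (m C suc ν) + fromℕ (m C ν)     ∎
    where open ≈-Reasoning
  pascal -[1+ zero ] ν = begin
    0#                                    ≈⟨ sym (-‿inverseˡ (sgn ν)) ⟩
    - sgn ν + sgn ν                       ≈⟨ +-cong (trans (sym (sgn-suc ν)) (sym (times-1 (suc ν)))) (sym (times-1 ν)) ⟩
    sgn (suc ν) * fromℕ (suc ν C suc ν) + sgn ν * fromℕ (ν C ν)
                                          ≈⟨ sym (+-cong (binomSeries-neg 0 (suc ν)) (binomSeries-neg 0 ν)) ⟩
    binomSeries -[1+ 0 ] (suc ν) + binomSeries -[1+ 0 ] ν ∎
    where
    open ≈-Reasoning
    times-1 : ∀ ν → sgn ν * fromℕ (ν C ν) ≈ sgn ν
    times-1 ν = trans (*-congˡ (reflexive (P.cong fromℕ (nCn≡1 ν)))) (trans (*-congˡ (+-identityʳ 1#)) (*-identityʳ _))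
  pascal -[1+ suc m ] ν = begin
    binomSeries -[1+ m ] (suc ν)
      ≈⟨ binomSeries-neg m (suc ν) ⟩
    sgn (suc ν) * fromℕ ((m ℕ.+ suc ν) C suc ν)
      ≡⟨ P.cong (λ z → sgn (suc ν) * fromℕ (z C suc ν)) (ℕP.+-suc m ν) ⟩
    sgn (suc ν) * Ca (suc ν)
      ≈⟨ sym (solve 3 (λ s x y → s :* (x :+ y) :+ (:- s) :* x := s :* y) refl _ _ _) ⟩
    sgn (suc ν) * (Ca ν + Ca (suc ν)) + - sgn (suc ν) * Ca ν
      ≈⟨ +-cong (*-congˡ (sym (fromℕ-+ (a C ν) (a C suc ν)))) (*-congʳ (trans (-‿cong (sgn-suc ν)) (-‿involutive _))) ⟩
    sgn (suc ν) * fromℕ (a C ν ℕ.+ a C suc ν) + sgn ν * Ca ν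
      ≡⟨ P.cong (λ z → sgn (suc ν) * fromℕ z + sgn ν * Ca ν)
                (P.trans (nCk+nC[k+1]≡[n+1]C[k+1] a ν) (P.cong (_C suc ν) a+1≡m+2+ν)) ⟩
    sgn (suc ν) * fromℕ ((suc m ℕ.+ suc ν) C suc ν) + sgn ν * Ca ν
      ≈⟨ sym (+-cong (binomSeries-neg (suc m) (suc ν)) (binomSeries-neg (suc m) ν)) ⟩
    binomSeries -[1+ suc m ] (suc ν) + binomSeries -[1+ suc m ] ν ∎
    where
    open ≈-Reasoning
    open Solver
    a : ℕ
    a = suc (m ℕ.+ ν)
    Ca : ℕ → Carrier
    Ca k = fromℕ (a C k)
    a+1≡m+2+ν : suc a ≡ suc m ℕ.+ suc ν
    a+1≡m+2+ν = P.sym (ℕP.+-suc (suc m) ν)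

  binomSeries-suc : ∀ e → binomSeries (e ℤ.+ + 1) ≐ 1+X *S binomSeries e
  binomSeries-suc e zero    = trans (binomSeries-coeff-0 (e ℤ.+ + 1))
                                    (sym (trans (1+X*S-zero (binomSeries e)) (binomSeries-coeff-0 e)))
  binomSeries-suc e (suc ν) = trans (pascal e ν) (sym (1+X*S-suc (binomSeries e) ν))

  1+X-cancel : ∀ s t → 1+X *S s ≐ 1+X *S t → s ≐ t
  1+X-cancel = linear-cancel 1# 1# 1# (*-identityˡ 1#)

  binomSeries-+ : ∀ a b → binomSeries a *S binomSeries b ≐ binomSeries (a ℤ.+ b)
  binomSeries-+ (+ m)    = from-+ m
    where
    open ≐-Reasoning
    open CommSemigroupProperties ℤP.+-commutativeSemigroup using (xy∙z≈xz∙y)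
    from-+ : ∀ m b → binomSeries (+ m) *S binomSeries b ≐ binomSeries (+ m ℤ.+ b)
    from-+ zero b = S.trans (*S-congʳ (binomSeries b) binomSeries-+0)
      (S.trans (S.*-identityˡ (binomSeries b)) (S.reflexive (P.cong binomSeries (P.sym (ℤP.+-identityˡ b)))))
    from-+ (suc m) b = begin 
      binomSeries (+ suc m) *S binomSeries b
        ≈⟨ *S-congʳ (binomSeries b) (S.trans (S.reflexive (P.cong binomSeries 1+m≡m+1)) (binomSeries-suc (+ m))) ⟩
      (1+X *S binomSeries (+ m)) *S binomSeries b
        ≈⟨ S.*-assoc 1+X (binomSeries (+ m)) (binomSeries b) ⟩
      1+X *S (binomSeries (+ m) *S binomSeries b)
        ≈⟨ *S-congˡ 1+X (from-+ m b) ⟩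
      1+X *S binomSeries (+ m ℤ.+ b)
        ≈⟨ S.sym (binomSeries-suc (+ m ℤ.+ b)) ⟩
      binomSeries (+ m ℤ.+ b ℤ.+ + 1)
        ≡⟨ P.cong binomSeries (P.trans (xy∙z≈xz∙y (+ m) b (+ 1)) (P.cong (ℤ._+ b) (P.sym 1+m≡m+1))) ⟩
      binomSeries (+ suc m ℤ.+ b) ∎
      where
      1+m≡m+1 : + suc m ≡ + m ℤ.+ + 1
      1+m≡m+1 = P.cong +_ (ℕP.+-comm 1 m)
  binomSeries-+ -[1+ m ] = from-− m
    where
    open ≐-Reasoning
    open CommSemigroupProperties ℤP.+-commutativeSemigroup using (xy∙z≈xz∙y)
    lower : ∀ a → (∀ b → binomSeries (a ℤ.+ + 1) *S binomSeries b ≐ binomSeries (a ℤ.+ + 1 ℤ.+ b))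
                → (∀ b → binomSeries a *S binomSeries b ≐ binomSeries (a ℤ.+ b))
    lower a h b = 1+X-cancel _ _ (begin 
      1+X *S (binomSeries a *S binomSeries b)      ≈⟨ S.sym (S.*-assoc 1+X (binomSeries a) (binomSeries b)) ⟩
      (1+X *S binomSeries a) *S binomSeries b      ≈⟨ *S-congʳ (binomSeries b) (S.sym (binomSeries-suc a)) ⟩
      binomSeries (a ℤ.+ + 1) *S binomSeries b     ≈⟨ h b ⟩
      binomSeries (a ℤ.+ + 1 ℤ.+ b)                ≡⟨ P.cong binomSeries (xy∙z≈xz∙y a (+ 1) b) ⟩
      binomSeries (a ℤ.+ b ℤ.+ + 1)                ≈⟨ binomSeries-suc (a ℤ.+ b) ⟩
      1+X *S binomSeries (a ℤ.+ b)                 ∎)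
    from-− : ∀ m b → binomSeries -[1+ m ] *S binomSeries b ≐ binomSeries (-[1+ m ] ℤ.+ b)
    from-− zero    = lower -[1+ 0 ] (binomSeries-+ (+ 0))
    from-− (suc m) = lower -[1+ suc m ] (from-− m)

  fromℕ-suc*binomSeries : ∀ e k → fromℕ (suc k) * binomSeries e (suc k) ≈ fromℤ e * binomSeries (e ℤ.- + 1) k
  fromℕ-suc*binomSeries (+ zero)  k = trans (zeroʳ _) (sym (zeroˡ _))
  fromℕ-suc*binomSeries (+ suc m) k = begin
    fromℕ (suc k) * fromℕ (suc m C suc k)  ≈⟨ sym (fromℕ-* (suc k) (suc m C suc k)) ⟩
    fromℕ (suc k ℕ.* (suc m C suc k))      ≡⟨ P.cong fromℕ (BinomialCoefficients.absorption m k) ⟩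
    fromℕ (suc m ℕ.* (m C k))              ≈⟨ fromℕ-* (suc m) (m C k) ⟩
    fromℕ (suc m) * fromℕ (m C k)          ∎
    where open ≈-Reasoning
  fromℕ-suc*binomSeries -[1+ m ] k = begin
    fromℕ (suc k) * binomSeries -[1+ m ] (suc k)
      ≈⟨ *-congˡ (trans (binomSeries-neg m (suc k)) (*-congʳ (sgn-suc k))) ⟩
    fromℕ (suc k) * (- sgn k * fromℕ ((m ℕ.+ suc k) C suc k))
      ≈⟨ solve 3 (λ a s b → a :* ((:- s) :* b) := (:- s) :* (a :* b)) refl _ _ _ ⟩
    - sgn k * (fromℕ (suc k) * fromℕ ((m ℕ.+ suc k) C suc k))
      ≈⟨ *-congˡ (trans (sym (fromℕ-* (suc k) ((m ℕ.+ suc k) C suc k)))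
                        (trans (reflexive (P.cong fromℕ (BinomialCoefficients.absorption-shifted m k)))
                               (fromℕ-* (suc m) ((suc m ℕ.+ k) C k)))) ⟩
    - sgn k * (fromℕ (suc m) * fromℕ ((suc m ℕ.+ k) C k))
      ≈⟨ solve 3 (λ s a b → (:- s) :* (a :* b) := (:- a) :* (s :* b)) refl _ _ _ ⟩
    - fromℕ (suc m) * (sgn k * fromℕ ((suc m ℕ.+ k) C k))
      ≡⟨ P.cong (λ z → - fromℕ (suc m) * (sgn k * fromℕ ((suc z ℕ.+ k) C k))) (P.sym (ℕP.+-identityʳ m)) ⟩
    - fromℕ (suc m) * (sgn k * fromℕ ((suc (m ℕ.+ 0) ℕ.+ k) C k))
      ≈⟨ *-congˡ (sym (binomSeries-neg (suc (m ℕ.+ 0)) k)) ⟩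
    - fromℕ (suc m) * binomSeries -[1+ suc (m ℕ.+ 0) ] k ∎
    where
    open Solver
    open ≈-Reasoning

  k!*gbinom≈ffall : ∀ k e → fromℕ (k !) * fromℤ (gbinom e k) ≈ fromℤ (ffall e k)
  k!*gbinom≈ffall zero    e = trans (*-congˡ (binomSeries-coeff-0 e)) (*-identityʳ _)
  k!*gbinom≈ffall (suc k) e = begin
    fromℕ (suc k ℕ.* k !) * binomSeries e (suc k)
      ≈⟨ trans (*-congʳ (fromℕ-* (suc k) (k !))) (solve 3 (λ a b g → (a :* b) :* g := b :* (a :* g)) refl _ _ _) ⟩
    fromℕ (k !) * (fromℕ (suc k) * binomSeries e (suc k))
      ≈⟨ *-congˡ (fromℕ-suc*binomSeries e k) ⟩
    fromℕ (k !) * (fromℤ e * binomSeries (e ℤ.- + 1) k)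
      ≈⟨ solve 3 (λ b a g → b :* (a :* g) := a :* (b :* g)) refl _ _ _ ⟩
    fromℤ e * (fromℕ (k !) * binomSeries (e ℤ.- + 1) k)
      ≈⟨ *-congˡ (k!*gbinom≈ffall k (e ℤ.- + 1)) ⟩
    fromℤ e * fromℤ (ffall (e ℤ.- + 1) k)
      ≈⟨ sym (fromℤ-* e _) ⟩
    fromℤ (ffall e (suc k)) ∎
    where
    open Solver
    open ≈-Reasoning

  inv1+X : FPS
  inv1+X = binomSeries -[1+ 0 ]

  1+X*inv1+X : 1+X *S inv1+X ≐ 1S
  1+X*inv1+X = S.trans (S.sym (binomSeries-suc -[1+ 0 ])) binomSeries-+0

  inv1+X^ : ∀ μ → OS.pow inv1+X μ ≐ binomSeries (ℤ.- + μ)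
  inv1+X^ zero          = S.sym binomSeries-+0
  inv1+X^ (suc zero)    = S.*-identityʳ inv1+X
  inv1+X^ (suc (suc μ)) = S.trans (*S-congˡ inv1+X (inv1+X^ (suc μ))) (binomSeries-+ -[1+ 0 ] -[1+ μ ])

  binomSeries*inv1+X^ : ∀ j μ → binomSeries j *S OS.pow inv1+X μ ≐ binomSeries (j ℤ.- + μ)
  binomSeries*inv1+X^ j μ = S.trans (*S-congˡ (binomSeries j) (inv1+X^ μ)) (binomSeries-+ j (ℤ.- + μ))

module SeriesEvaluation {c ℓ} (R : CommutativeRing c ℓ) where
  open CommutativeRing R
  open Over R
  open Numerals R
  open FiniteSums R
  open PowerSeries R
  open Evaluation R FPS-commutativeRing constS constS-cong constS-+ constS-* constS-0 public

  ev-X : ∀ p → ev p X ≐ coeff p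
  ev-X []      i       = refl
  ev-X (a ∷ p) zero    = trans (+-congˡ (X*S-zero (ev p X))) (+-identityʳ a)
  ev-X (a ∷ p) (suc i) = trans (+-congˡ (X*S-suc (ev p X) i)) (trans (+-identityˡ _) (ev-X p i))

  ≋-from-ev-X : ∀ p q → ev p X ≐ ev q X → p ≋ q
  ≋-from-ev-X p q h i = trans (sym (ev-X p i)) (trans (h i) (ev-X q i))

  ev-−X : ∀ p i → ev p (-S X) i ≈ sgn i * coeff p i
  ev-−X []      i       = sym (zeroʳ _)
  ev-−X (a ∷ p) zero    = begin
    a + ((-S X) *S ev p (-S X)) 0
      ≈⟨ +-congˡ (trans (sym (NS.-‿distribˡ-* X (ev p (-S X)) 0)) (-‿cong (X*S-zero (ev p (-S X))))) ⟩
    a + - 0#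
      ≈⟨ trans (+-congˡ -0#≈0#) (+-identityʳ a) ⟩
    a
      ≈⟨ sym (*-identityˡ a) ⟩
    1# * a ∎
    where open ≈-Reasoning
  ev-−X (a ∷ p) (suc i) = begin
    0# + ((-S X) *S ev p (-S X)) (suc i)  ≈⟨ trans (+-identityˡ _) (sym (NS.-‿distribˡ-* X (ev p (-S X)) (suc i))) ⟩
    - (X *S ev p (-S X)) (suc i)          ≈⟨ -‿cong (trans (X*S-suc (ev p (-S X)) i) (ev-−X p i)) ⟩
    - (sgn i * coeff p i)                 ≈⟨ trans (-‿distribˡ-* _ _) (*-congʳ (sym (sgn-suc i))) ⟩
    sgn (suc i) * coeff p i               ∎
    where open ≈-Reasoning

  ev-coeff-0 : ∀ p w → w 0 ≈ 0# → ev p w 0 ≈ coeff p 0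
  ev-coeff-0 []      w w₀≈0 = refl
  ev-coeff-0 (a ∷ p) w w₀≈0 = trans (+-congˡ (trans (*-congʳ w₀≈0) (zeroˡ _))) (+-identityʳ a)

  ev-injective : ∀ w → w 0 ≈ 0# → (∀ s t → w *S s ≐ w *S t → s ≐ t) →
                 ∀ p q → ev p w ≐ ev q w → p ≋ q
  ev-injective w w₀≈0 cancel p q e zero = begin
    coeff p 0  ≈⟨ sym (ev-coeff-0 p w w₀≈0) ⟩
    ev p w 0   ≈⟨ e 0 ⟩
    ev q w 0   ≈⟨ ev-coeff-0 q w w₀≈0 ⟩
    coeff q 0  ∎
    where open ≈-Reasoning
  ev-injective w w₀≈0 cancel p q e (suc i) = trans (coeff-tail p i)
    (trans (ev-injective w w₀≈0 cancel (tail p) (tail q) (cancel _ _ tails) i) (sym (coeff-tail q i)))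
    where
    tail : Poly → Poly
    tail []      = []
    tail (_ ∷ p) = p
    coeff-tail : ∀ p i → coeff p (suc i) ≈ coeff (tail p) i
    coeff-tail []      i = refl
    coeff-tail (a ∷ p) i = refl
    split : ∀ p → ev p w ≐ constS (coeff p 0) +S w *S ev (tail p) w
    split []      = S.sym (S.trans (S.+-congʳ constS-0) (S.trans (S.+-identityˡ _) (S.zeroʳ w)))
    split (a ∷ p) = S.refl
    heads : constS (coeff p 0) ≐ constS (coeff q 0)
    heads = constS-cong (ev-injective w w₀≈0 cancel p q e 0)
    tails : w *S ev (tail p) w ≐ w *S ev (tail q) w
    tails = NS.+-cancelˡ (constS (coeff p 0)) _ _
      (S.trans (S.sym (split p)) (S.trans e (S.trans (split q) (S.+-congʳ (S.sym heads)))))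

  ev-as-sum : ∀ p N z → (∀ j → N < j → coeff p j ≈ 0#) →
              ev p z ≐ OS.sumTo N (λ j → constS (coeff p j) *S OS.pow z j)
  ev-as-sum []      N       z h = S.sym (FS.sumTo-zero N _ (λ j _ → S.trans (*S-congʳ (OS.pow z j) constS-0) (S.zeroˡ (OS.pow z j))))
  ev-as-sum (a ∷ p) zero    z h = begin
    constS a +S z *S ev p z  ≈⟨ S.+-congˡ (S.trans (*S-congˡ z (ev-zero p z (λ j → h (suc j) (s≤s z≤n)))) (S.zeroʳ z)) ⟩
    constS a +S 0S           ≈⟨ S.trans (S.+-identityʳ _) (S.sym (S.*-identityʳ _)) ⟩
    constS a *S 1S           ∎
    where open ≐-Reasoning
  ev-as-sum (a ∷ p) (suc N) z h = begin
    constS a +S z *S ev p z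
      ≈⟨ S.+-cong (S.sym (S.*-identityʳ _)) (*S-congˡ z (ev-as-sum p N z (λ j N<j → h (suc j) (s≤s N<j)))) ⟩
    constS a *S 1S +S z *S OS.sumTo N (λ j → constS (coeff p j) *S OS.pow z j)
      ≈⟨ S.+-congˡ (S.trans (FS.sumTo-*ˡ N z _) (FS.sumTo-cong N (λ j → x∙yz≈y∙xz z (constS (coeff p j)) (OS.pow z j)))) ⟩
    constS a *S 1S +S OS.sumTo N (λ j → constS (coeff p j) *S (z *S OS.pow z j))
      ≈⟨ S.sym (FS.sumTo-suc N (λ j → constS (coeff (a ∷ p) j) *S OS.pow z j)) ⟩
    OS.sumTo (suc N) (λ j → constS (coeff (a ∷ p) j) *S OS.pow z j) ∎
    where
    open ≐-Reasoning
    open CommSemigroupProperties S.*-commutativeSemigroup using (x∙yz≈y∙xz)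

module LaurentDerivatives {c ℓ} (R : CommutativeRing c ℓ) where
  open CommutativeRing R
  open Over R
  open Numerals R
  open FiniteSums R

  -- the value at x = 1 of the k-th derivative of the monomial a x^e
  fallingTerm : ℕ → Carrier × ℤ → Carrier
  fallingTerm k (a , e) = fromℤ (ffall e k) * a

  fallingSum : ℕ → LPoly → Carrier
  fallingSum k = foldr (λ t acc → fallingTerm k t + acc) 0#

  pow-1# : ∀ m → pow 1# m ≈ 1#
  pow-1# zero    = refl
  pow-1# (suc m) = trans (*-identityˡ _) (pow-1# m)

  evalL-1 : ∀ L → evalL 1# 1# L ≈ fallingSum 0 L
  evalL-1 []             = refl
  evalL-1 ((a , e) ∷ L) = +-cong (trans (*-congˡ (powℤ-1 e)) (trans (*-identityʳ a)
                                   (sym (trans (*-congʳ (+-identityʳ 1#)) (*-identityˡ a)))))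
                                 (evalL-1 L)
    where
    powℤ-1 : ∀ e → powℤ 1# 1# e ≈ 1#
    powℤ-1 (+ m)    = pow-1# m
    powℤ-1 -[1+ m ] = pow-1# (suc m)

  fallingSum-derivL : ∀ k L → fallingSum k (derivL L) ≈ fallingSum (suc k) L
  fallingSum-derivL k []             = refl
  fallingSum-derivL k ((a , e) ∷ L) = +-cong step (fallingSum-derivL k L)
    where
    open Solver
    step : fromℤ (ffall (e ℤ.- + 1) k) * (fromℤ e * a) ≈ fromℤ (e ℤ.* ffall (e ℤ.- + 1) k) * a
    step = trans (solve 3 (λ f x a → f :* (x :* a) := (x :* f) :* a) refl _ _ _) (*-congʳ (sym (fromℤ-* e _)))

  evalL-1-derivLⁿ : ∀ k L → evalL 1# 1# (derivLⁿ k L) ≈ fallingSum k L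
  evalL-1-derivLⁿ zero    L = evalL-1 L
  evalL-1-derivLⁿ (suc k) L = trans (reflexive (P.cong (evalL 1# 1#) (derivLⁿ-suc k L)))
                                    (trans (evalL-1-derivLⁿ k (derivL L)) (fallingSum-derivL k L))
    where
    derivLⁿ-suc : ∀ k L → derivLⁿ (suc k) L ≡ derivLⁿ k (derivL L)
    derivLⁿ-suc zero    L = P.refl
    derivLⁿ-suc (suc k) L = P.cong derivL (derivLⁿ-suc k L)

  fallingSum-applyUpTo : ∀ k m g → fallingSum k (applyUpTo g (suc m)) ≈ sumTo m (λ ν → fallingTerm k (g ν))
  fallingSum-applyUpTo k zero    g = +-identityʳ _
  fallingSum-applyUpTo k (suc m) g = trans (+-congˡ (fallingSum-applyUpTo k m (λ i → g (suc i)))) (sym (sumTo-suc m _))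

module OddAppell {c ℓ} (R : CommutativeRing c ℓ)
  (inverse : ℕ → CommutativeRing.Carrier R)
  (inverse-correct : ∀ m → CommutativeRing._≈_ R (CommutativeRing._*_ R (Over.fromℕ R (suc m)) (inverse m))
                                                  (CommutativeRing.1# R))
  (α : ℕ → CommutativeRing.Carrier R) (n d : ℕ) (n≡1+2d : n ≡ suc (d ℕ.+ d))
  (A-reflection : Over._≋_ R (Over._∘P_ R (Over.Appell R α n) (Over.oneMinusX R))
                              (Over.scaleP R (Over.sgn R n) (Over.Appell R α n)))
  where
  open CommutativeRing R
  open Over R
  open Numerals R
  open FiniteSums R
  open Polynomials R
  open PowerSeries R
  open BinomialSeries R
  open SeriesEvaluation R
  open LaurentDerivatives R

  -- The factorisation A_n = (2x - 1) F(x(x - 1))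

  fromℕ-suc-cancel : ∀ m {x y} → fromℕ (suc m) * x ≈ fromℕ (suc m) * y → x ≈ y
  fromℕ-suc-cancel m {x} {y} e = begin
    x
      ≈⟨ sym (trans (*-congʳ (trans (*-comm _ _) (inverse-correct m))) (*-identityˡ x)) ⟩
    (inverse m * fromℕ (suc m)) * x
      ≈⟨ trans (*-assoc _ _ _) (*-congˡ e) ⟩
    inverse m * (fromℕ (suc m) * y)
      ≈⟨ trans (sym (*-assoc _ _ _)) (trans (*-congʳ (trans (*-comm _ _) (inverse-correct m))) (*-identityˡ y)) ⟩
    y ∎
    where open ≈-Reasoning

  x≈-x⇒x≈0 : ∀ {x} → x ≈ - x → x ≈ 0#
  x≈-x⇒x≈0 {x} x≈-x = fromℕ-suc-cancel 1 (begin
    fromℕ 2 * x   ≈⟨ *-congʳ (sym (fromℕ′≈fromℕ 2)) ⟩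
    fromℕ′ 2 * x  ≈⟨ solve 1 (λ x → con (+ 2) :* x := x :+ x) refl x ⟩
    x + x         ≈⟨ trans (+-congˡ x≈-x) (-‿inverseʳ x) ⟩
    0#            ≈⟨ sym (zeroʳ _) ⟩
    fromℕ 2 * 0#  ∎)
    where
    open ≈-Reasoning
    open Solver

  A : Poly
  A = Appell α n

  sgn-n : sgn n ≈ - 1#
  sgn-n = P.subst (λ m → sgn m ≈ - 1#) (P.sym n≡1+2d) (trans (sgn-suc (d ℕ.+ d)) (-‿cong (sgn-even d)))

  ev-oneMinusX : ∀ z → ev oneMinusX z ≐ 1S +S -S z
  ev-oneMinusX z = begin
    constS 1# +S z *S (constS (- 1#) +S z *S 0S)
      ≈⟨ S.+-congˡ {1S} (*S-congˡ z (S.+-congʳ {z *S 0S} (constS-neg 1#))) ⟩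
    1S +S z *S (-S 1S +S z *S 0S)
      ≈⟨ solve 1 (λ Z → con (+ 1) :+ Z :* (:- con (+ 1) :+ Z :* con (+ 0)) := con (+ 1) :+ :- Z) S.refl z ⟩
    1S +S -S z ∎
    where
    open ≐-Reasoning
    open NS.Solver

  ev-A-A-reflection : ∀ z w → z +S w ≐ 1S → ev A w ≐ -S ev A z
  ev-A-A-reflection z w z+w≐1 = begin
    ev A w
      ≈⟨ ev-congʳ A w≐1-z ⟩
    ev A (ev oneMinusX z)
      ≈⟨ S.sym (ev-∘P A oneMinusX z) ⟩
    ev (A ∘P oneMinusX) z
      ≈⟨ ev-cong (A ∘P oneMinusX) (scaleP (sgn n) A) z A-reflection ⟩
    ev (scaleP (sgn n) A) z
      ≈⟨ S.trans (ev-scaleP (sgn n) A z) (*S-congʳ (ev A z) (S.trans (constS-cong sgn-n) (constS-neg 1#))) ⟩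
    (-S 1S) *S ev A z
      ≈⟨ solve 1 (λ E → :- con (+ 1) :* E := :- E) S.refl (ev A z) ⟩
    -S ev A z ∎
    where
    open ≐-Reasoning
    open NS.Solver
    w≐1-z : w ≐ ev oneMinusX z
    w≐1-z = S.trans (S.trans (S.sym (solve 2 (λ Z W → (Z :+ W) :+ :- Z := W) S.refl z w)) (S.+-congʳ z+w≐1))
                    (S.sym (ev-oneMinusX z))

  half : Carrier
  half = inverse 1

  H : FPS
  H = constS half

  twoS : FPS
  twoS = 1S +S 1S

  constS-2 : constS (fromℕ 2) ≐ twoS
  constS-2 = S.trans (constS-fromℕ 2) (S.sym (NS.fromℕ′≈fromℕ 2))

  twoS*H : twoS *S H ≐ 1S
  twoS*H = S.trans (*S-congʳ H (S.sym constS-2)) (S.trans (S.sym (constS-* (fromℕ 2) half)) (constS-cong (inverse-correct 1)))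

  B : Poly
  B = A ∘P (half ∷ half ∷ [])

  ev-B : ∀ y → ev B y ≐ ev A (H +S H *S y)
  ev-B y = S.trans (ev-∘P A (half ∷ half ∷ []) y)
    (ev-congʳ A (solve 2 (λ H Y → H :+ Y :* (H :+ Y :* con (+ 0)) := H :+ H :* Y) S.refl H y))
    where open NS.Solver

  B-odd : ∀ i → sgn i * coeff B i ≈ - coeff B i
  B-odd i = begin
    sgn i * coeff B i           ≈⟨ sym (ev-−X B i) ⟩
    ev B (-S X) i               ≈⟨ ev-B (-S X) i ⟩
    ev A (H +S H *S (-S X)) i   ≈⟨ ev-A-A-reflection (H +S H *S X) (H +S H *S (-S X)) halves i ⟩
    - ev A (H +S H *S X) i      ≈⟨ -‿cong (trans (sym (ev-B X i)) (ev-X B i)) ⟩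
    - coeff B i                 ∎
    where
    open ≈-Reasoning
    open NS.Solver
    halves : (H +S H *S X) +S (H +S H *S (-S X)) ≐ 1S
    halves = S.trans (solve 2 (λ H Y → (H :+ H :* Y) :+ (H :+ H :* (:- Y)) := con (+ 2) :* H) S.refl H X) twoS*H

  B-even-coeff : ∀ j → coeff B (j ℕ.+ j) ≈ 0#
  B-even-coeff j = x≈-x⇒x≈0 (trans (sym (trans (*-congʳ (sgn-even j)) (*-identityˡ _))) (B-odd (j ℕ.+ j)))

  -- B(y) = y G(y²) with G = oddPart B, and (2x - 1)² = 1 + 4 x(x - 1).
  F : Poly
  F = oddPart B ∘P (1# ∷ fromℕ 4 ∷ [])

  ev-twoXminus1 : ∀ z → ev twoXminus1 z ≐ twoS *S z +S -S 1S
  ev-twoXminus1 z = begin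
    constS (- 1#) +S z *S (constS (fromℕ 2) +S z *S 0S)
      ≈⟨ S.+-cong (constS-neg 1#) (*S-congˡ z (S.+-congʳ {z *S 0S} constS-2)) ⟩
    -S 1S +S z *S (twoS +S z *S 0S)
      ≈⟨ solve 1 (λ Z → :- con (+ 1) :+ Z :* (con (+ 2) :+ Z :* con (+ 0)) := con (+ 2) :* Z :+ :- con (+ 1)) S.refl z ⟩
    twoS *S z +S -S 1S ∎
    where
    open ≐-Reasoning
    open NS.Solver

  ev-uPoly : ∀ z → ev uPoly z ≐ z *S z +S -S z
  ev-uPoly z = begin
    constS 0# +S z *S (constS (- 1#) +S z *S (1S +S z *S 0S))
      ≈⟨ S.+-cong constS-0 (*S-congˡ z (S.+-congʳ {z *S (1S +S z *S 0S)} (constS-neg 1#))) ⟩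
    0S +S z *S (-S 1S +S z *S (1S +S z *S 0S))
      ≈⟨ solve 1 (λ Z → con (+ 0) :+ Z :* (:- con (+ 1) :+ Z :* (con (+ 1) :+ Z :* con (+ 0))) := Z :* Z :+ :- Z) S.refl z ⟩
    z *S z +S -S z ∎
    where
    open ≐-Reasoning
    open NS.Solver

  ev-1+4X : ∀ w → ev (1# ∷ fromℕ 4 ∷ []) w ≐ 1S +S NS.fromℕ′ 4 *S w
  ev-1+4X w = begin
    1S +S w *S (constS (fromℕ 4) +S w *S 0S)
      ≈⟨ S.+-congˡ {1S} (*S-congˡ w (S.+-congʳ {w *S 0S} (S.trans (constS-fromℕ 4) (S.sym (NS.fromℕ′≈fromℕ 4))))) ⟩
    1S +S w *S (NS.fromℕ′ 4 +S w *S 0S)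
      ≈⟨ solve 1 (λ W → con (+ 1) :+ W :* (con (+ 4) :+ W :* con (+ 0)) := con (+ 1) :+ con (+ 4) :* W) S.refl w ⟩
    1S +S NS.fromℕ′ 4 *S w ∎
    where
    open ≐-Reasoning
    open NS.Solver

  ev-A-factorisation : ∀ z → ev A z ≐ ev twoXminus1 z *S ev F (ev uPoly z)
  ev-A-factorisation z = begin
    ev A z                                                    ≈⟨ ev-congʳ A z≐H+Hy ⟩
    ev A (H +S H *S y)                                        ≈⟨ S.sym (ev-B y) ⟩
    ev B y                                                    ≈⟨ ev-evenPart-oddPart B y ⟩
    ev (evenPart B) (y *S y) +S y *S ev (oddPart B) (y *S y)
      ≈⟨ S.+-congʳ (ev-zero (evenPart B) (y *S y) even-vanish) ⟩
    0S +S y *S ev (oddPart B) (y *S y)                        ≈⟨ S.trans (S.+-identityˡ _) (*S-congˡ y (S.sym ev-F-w)) ⟩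
    y *S ev F w                                               ∎
    where
    open ≐-Reasoning
    open NS.Solver
    y w : FPS
    y = ev twoXminus1 z
    w = ev uPoly z
    z≐H+Hy : z ≐ H +S H *S y
    z≐H+Hy = S.sym (S.trans (S.+-congˡ {H} (*S-congˡ H (ev-twoXminus1 z)))
      (S.trans (solve 3 (λ H Z T → H :+ H :* (T :* Z :+ :- con (+ 1)) := (T :* H) :* Z) S.refl H z twoS)
      (S.trans (*S-congʳ z twoS*H) (S.*-identityˡ z))))
    even-vanish : ∀ i → coeff (evenPart B) i ≈ 0#
    even-vanish i = trans (reflexive (coeff-evenPart B i)) (B-even-coeff i)
    ev-F-w : ev F w ≐ ev (oddPart B) (y *S y)
    ev-F-w = S.trans (ev-∘P (oddPart B) (1# ∷ fromℕ 4 ∷ []) w) (ev-congʳ (oddPart B) (begin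
      ev (1# ∷ fromℕ 4 ∷ []) w
        ≈⟨ S.trans (ev-1+4X w) (S.+-congˡ {1S} (*S-congˡ (NS.fromℕ′ 4) (ev-uPoly z))) ⟩
      1S +S NS.fromℕ′ 4 *S (z *S z +S -S z)
        ≈⟨ solve 1 (λ Z → con (+ 1) :+ con (+ 4) :* (Z :* Z :+ :- Z)
                       := (con (+ 2) :* Z :+ :- con (+ 1)) :* (con (+ 2) :* Z :+ :- con (+ 1))) S.refl z ⟩
      (twoS *S z +S -S 1S) *S (twoS *S z +S -S 1S)
        ≈⟨ S.sym (S.*-cong (ev-twoXminus1 z) (ev-twoXminus1 z)) ⟩
      y *S y ∎))

  Appell-factorisation : A ≋ twoXminus1 *P (F ∘P uPoly)
  Appell-factorisation = ≋-from-ev-X A (twoXminus1 *P (F ∘P uPoly)) (S.trans (ev-A-factorisation X)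
    (S.sym (S.trans (ev-*P twoXminus1 (F ∘P uPoly) X) (*S-congˡ (ev twoXminus1 X) (ev-∘P F uPoly X)))))

  -1*-1≈1 : - 1# * - 1# ≈ 1#
  -1*-1≈1 = solve 0 (:- con (+ 1) :* :- con (+ 1) := con (+ 1)) refl
    where open Solver

  ev-twoXminus1-X : ev twoXminus1 X ≐ linear (- 1#) (fromℕ 2)
  ev-twoXminus1-X = S.trans (ev-twoXminus1 X) (S.sym (S.trans (S.+-cong (constS-neg 1#) (*S-congʳ X constS-2))
    (solve 2 (λ Z T → :- con (+ 1) :+ T :* Z := T :* Z :+ :- con (+ 1)) S.refl X twoS)))
    where open NS.Solver

  twoXminus1-cancel : ∀ s t → ev twoXminus1 X *S s ≐ ev twoXminus1 X *S t → s ≐ t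
  twoXminus1-cancel s t e = linear-cancel (- 1#) (- 1#) (fromℕ 2) -1*-1≈1 s t
    (S.trans (*S-congʳ s (S.sym ev-twoXminus1-X)) (S.trans e (*S-congʳ t ev-twoXminus1-X)))

  ev-uPoly-X : ev uPoly X ≐ X *S linear (- 1#) 1#
  ev-uPoly-X = S.trans (ev-uPoly X) (S.sym (S.trans (*S-congˡ X (S.+-congʳ {constS 1# *S X} (constS-neg 1#)))
    (solve 1 (λ Z → Z :* (:- con (+ 1) :+ con (+ 1) :* Z) := Z :* Z :+ :- Z) S.refl X)))
    where open NS.Solver

  uPoly-cancel : ∀ s t → ev uPoly X *S s ≐ ev uPoly X *S t → s ≐ t
  uPoly-cancel s t e = linear-cancel (- 1#) (- 1#) 1# -1*-1≈1 s t (X-cancel _ _ (begin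
    X *S (linear (- 1#) 1# *S s)  ≈⟨ S.trans (S.sym (S.*-assoc X _ s)) (*S-congʳ s (S.sym ev-uPoly-X)) ⟩
    ev uPoly X *S s               ≈⟨ e ⟩
    ev uPoly X *S t               ≈⟨ S.trans (*S-congʳ t ev-uPoly-X) (S.*-assoc X _ t) ⟩
    X *S (linear (- 1#) 1# *S t)  ∎))
    where open ≐-Reasoning

  factorisation-unique : ∀ F′ → A ≋ twoXminus1 *P (F′ ∘P uPoly) → F′ ≋ F
  factorisation-unique F′ A≋F′ = ev-injective (ev uPoly X) (ev-X uPoly 0) uPoly-cancel F′ F
    (twoXminus1-cancel _ _ (begin
      ev twoXminus1 X *S ev F′ (ev uPoly X)  ≈⟨ S.sym (ev-factor F′) ⟩
      ev (twoXminus1 *P (F′ ∘P uPoly)) X    ≈⟨ S.sym (ev-cong A (twoXminus1 *P (F′ ∘P uPoly)) X A≋F′) ⟩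
      ev A X                                ≈⟨ ev-cong A (twoXminus1 *P (F ∘P uPoly)) X Appell-factorisation ⟩
      ev (twoXminus1 *P (F ∘P uPoly)) X     ≈⟨ ev-factor F ⟩
      ev twoXminus1 X *S ev F (ev uPoly X)   ∎))
    where
    open ≐-Reasoning
    ev-factor : ∀ Q → ev (twoXminus1 *P (Q ∘P uPoly)) X ≐ ev twoXminus1 X *S ev Q (ev uPoly X)
    ev-factor Q = S.trans (ev-*P twoXminus1 (Q ∘P uPoly) X) (*S-congˡ (ev twoXminus1 X) (ev-∘P Q uPoly X))

  -- Coefficients through the substitution x = 1/(1 + t)

  appellCoeff : ℕ → ℕ → Carrier
  appellCoeff m ν = fromℕ (m C ν) * α (m ∸ ν)

  Acoeff : ℕ → Carrier
  Acoeff = appellCoeff n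

  +m-+n≡+[m∸n] : ∀ {m k} → k ≤ m → + m ℤ.- + k ≡ + (m ∸ k)
  +m-+n≡+[m∸n] {m} {k} k≤m = P.trans (ℤP.m-n≡m⊖n m k) (ℤP.⊖-≥ k≤m)

  binomSeries*ev-A : ∀ j z → binomSeries j *S ev A z ≐ OS.sumTo n (λ μ → constS (Acoeff μ) *S (binomSeries j *S OS.pow z μ))
  binomSeries*ev-A j z = begin
    binomSeries j *S ev A z
      ≈⟨ *S-congˡ (binomSeries j) (ev-applyUpTo n Acoeff z) ⟩
    binomSeries j *S OS.sumTo n (λ μ → constS (Acoeff μ) *S OS.pow z μ)
      ≈⟨ FS.sumTo-*ˡ n (binomSeries j) _ ⟩
    OS.sumTo n (λ μ → binomSeries j *S (constS (Acoeff μ) *S OS.pow z μ))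
      ≈⟨ FS.sumTo-cong n (λ μ → x∙yz≈y∙xz (binomSeries j) (constS (Acoeff μ)) (OS.pow z μ)) ⟩
    OS.sumTo n (λ μ → constS (Acoeff μ) *S (binomSeries j *S OS.pow z μ)) ∎
    where
    open ≐-Reasoning
    open CommSemigroupProperties S.*-commutativeSemigroup using (x∙yz≈y∙xz)

  binomSeries*ev-A-inv1+X : ∀ j i → (binomSeries j *S ev A inv1+X) i ≈ sumTo n (λ μ → Acoeff μ * binomSeries (j ℤ.- + μ) i)
  binomSeries*ev-A-inv1+X j i = begin
    (binomSeries j *S ev A inv1+X) i                                  ≈⟨ binomSeries*ev-A j inv1+X i ⟩
    OS.sumTo n (λ μ → constS (Acoeff μ) *S (binomSeries j *S OS.pow inv1+X μ)) i
      ≈⟨ sumToS-coeff n _ i ⟩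
    sumTo n (λ μ → (constS (Acoeff μ) *S (binomSeries j *S OS.pow inv1+X μ)) i)
      ≈⟨ sumTo-cong n (λ μ → trans (constS-*S (Acoeff μ) (binomSeries j *S OS.pow inv1+X μ) i)
                                   (*-congˡ (binomSeries*inv1+X^ j μ i))) ⟩
    sumTo n (λ μ → Acoeff μ * binomSeries (j ℤ.- + μ) i)              ∎
    where open ≈-Reasoning

  Cpoly-as-substitution : toFPS (Cpoly α n) ≐ binomSeries (+ n) *S ev A inv1+X
  Cpoly-as-substitution i with i ℕP.≤? n
  ... | yes i≤n = begin
    coeff (Cpoly α n) i                                 ≡⟨ coeff-applyUpTo-< (aCoef α n) (suc n) i (s≤s i≤n) ⟩
    aCoef α n i                                         ≈⟨ sumFromTo≈sumTo i n g g-vanishes ⟩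
    sumTo n g                                           ≈⟨ sumTo-reverse n g ⟩
    sumTo n (λ μ → g (n ∸ μ))                           ≈⟨ sumTo-cong-≤ n reindex ⟩
    sumTo n (λ μ → Acoeff μ * binomSeries (+ n ℤ.- + μ) i) ≈⟨ sym (binomSeries*ev-A-inv1+X (+ n) i) ⟩
    (binomSeries (+ n) *S ev A inv1+X) i                ∎
    where
    open ≈-Reasoning
    open Solver
    g : ℕ → Carrier
    g ν = fromℕ (n C ν) * (fromℕ (ν C i) * α ν)
    g-vanishes : ∀ ν → ν < i → g ν ≈ 0#
    g-vanishes ν ν<i = trans (*-congˡ (trans (*-congʳ (reflexive (P.cong fromℕ (k>n⇒nCk≡0 ν<i)))) (zeroˡ _))) (zeroʳ _)
    reindex : ∀ μ → μ ≤ n → g (n ∸ μ) ≈ Acoeff μ * binomSeries (+ n ℤ.- + μ) i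
    reindex μ μ≤n = begin
      fromℕ (n C (n ∸ μ)) * (fromℕ ((n ∸ μ) C i) * α (n ∸ μ))
        ≡⟨ P.cong (λ z → fromℕ z * (fromℕ ((n ∸ μ) C i) * α (n ∸ μ))) (P.sym (nCk≡nC[n∸k] μ≤n)) ⟩
      fromℕ (n C μ) * (fromℕ ((n ∸ μ) C i) * α (n ∸ μ))
        ≈⟨ solve 3 (λ a b c → a :* (b :* c) := (a :* c) :* b) refl (fromℕ (n C μ)) _ (α (n ∸ μ)) ⟩
      Acoeff μ * fromℕ ((n ∸ μ) C i)
        ≡⟨ P.cong (λ e → Acoeff μ * binomSeries e i) (P.sym (+m-+n≡+[m∸n] μ≤n)) ⟩
      Acoeff μ * binomSeries (+ n ℤ.- + μ) i ∎
  ... | no i≰n = begin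
    coeff (Cpoly α n) i                                    ≡⟨ coeff-applyUpTo-≥ (aCoef α n) (suc n) i (ℕP.≰⇒> i≰n) ⟩
    0#                                                     ≈⟨ sym (sumTo-zero n _ term-vanishes) ⟩
    sumTo n (λ μ → Acoeff μ * binomSeries (+ n ℤ.- + μ) i) ≈⟨ sym (binomSeries*ev-A-inv1+X (+ n) i) ⟩
    (binomSeries (+ n) *S ev A inv1+X) i                   ∎
    where
    open ≈-Reasoning
    term-vanishes : ∀ μ → μ ≤ n → Acoeff μ * binomSeries (+ n ℤ.- + μ) i ≈ 0#
    term-vanishes μ μ≤n = trans (*-congˡ (reflexive (P.trans (P.cong (λ e → binomSeries e i) (+m-+n≡+[m∸n] μ≤n))
      (P.cong fromℕ (k>n⇒nCk≡0 (ℕP.≤-<-trans (ℕP.m∸n≤m n μ) (ℕP.≰⇒> i≰n))))))) (zeroʳ _)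

  Cser-as-substitution : ∀ j → Cser α n j ≐ binomSeries j *S ev A inv1+X
  Cser-as-substitution j = begin
    toFPS (Cpoly α n) *S binomSeries (j ℤ.- + n)
      ≈⟨ *S-congʳ (binomSeries (j ℤ.- + n)) Cpoly-as-substitution ⟩
    (binomSeries (+ n) *S ev A inv1+X) *S binomSeries (j ℤ.- + n)
      ≈⟨ xy∙z≈xz∙y (binomSeries (+ n)) (ev A inv1+X) (binomSeries (j ℤ.- + n)) ⟩
    (binomSeries (+ n) *S binomSeries (j ℤ.- + n)) *S ev A inv1+X
      ≈⟨ *S-congʳ (ev A inv1+X) (binomSeries-+ (+ n) (j ℤ.- + n)) ⟩
    binomSeries (+ n ℤ.+ (j ℤ.- + n)) *S ev A inv1+X
      ≡⟨ P.cong (λ e → binomSeries e *S ev A inv1+X) (m+[j-m]≡j (+ n) j) ⟩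
    binomSeries j *S ev A inv1+X ∎
    where
    open ≐-Reasoning
    open CommSemigroupProperties S.*-commutativeSemigroup using (xy∙z≈xz∙y)
    m+[j-m]≡j : ∀ m j → m ℤ.+ (j ℤ.- m) ≡ j
    m+[j-m]≡j m j = P.trans (P.cong (λ x → m ℤ.+ x) (ℤP.+-comm j (ℤ.- m)))
      (P.trans (P.sym (ℤP.+-assoc m (ℤ.- m) j)) (P.trans (P.cong (ℤ._+ j) (ℤP.+-inverseʳ m)) (ℤP.+-identityˡ j)))

  1-X : FPS
  1-X = 1S +S -S X

  1-X*S-zero : ∀ s → (1-X *S s) 0 ≈ s 0
  1-X*S-zero s = trans (*S-distribʳ s 1S (-S X) 0)
    (trans (+-cong (*S-identityˡ s 0) (trans (sym (NS.-‿distribˡ-* X s 0)) (-‿cong (X*S-zero s))))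
    (trans (+-congˡ -0#≈0#) (+-identityʳ _)))

  1-X*S-suc : ∀ s i → (1-X *S s) (suc i) ≈ s (suc i) - s i
  1-X*S-suc s i = trans (*S-distribʳ s 1S (-S X) (suc i))
    (+-cong (*S-identityˡ s (suc i)) (trans (sym (NS.-‿distribˡ-* X s (suc i))) (-‿cong (X*S-suc s i))))

  ev-twoXminus1-inv1+X : ev twoXminus1 inv1+X ≐ 1-X *S inv1+X
  ev-twoXminus1-inv1+X = begin
    ev twoXminus1 inv1+X
      ≈⟨ ev-twoXminus1 inv1+X ⟩
    twoS *S inv1+X +S -S 1S
      ≈⟨ S.+-congˡ {twoS *S inv1+X} (S.-‿cong (S.sym 1+X*inv1+X)) ⟩
    twoS *S inv1+X +S -S (1+X *S inv1+X)
      ≈⟨ solve 2 (λ Y E → con (+ 2) :* E :+ :- ((con (+ 1) :+ con (+ 1) :* Y) :* E) := (con (+ 1) :+ :- Y) :* E) S.refl X inv1+X ⟩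
    1-X *S inv1+X ∎
    where
    open ≐-Reasoning
    open NS.Solver

  ev-uPoly-inv1+X : ev uPoly inv1+X ≐ (-S X) *S (inv1+X *S inv1+X)
  ev-uPoly-inv1+X = begin
    ev uPoly inv1+X
      ≈⟨ ev-uPoly inv1+X ⟩
    inv1+X *S inv1+X +S -S inv1+X
      ≈⟨ S.+-congˡ {inv1+X *S inv1+X} (S.-‿cong (S.sym (S.trans (*S-congʳ inv1+X 1+X*inv1+X) (S.*-identityˡ inv1+X)))) ⟩
    inv1+X *S inv1+X +S -S ((1+X *S inv1+X) *S inv1+X)
      ≈⟨ solve 2 (λ Y E → E :* E :+ :- (((con (+ 1) :+ con (+ 1) :* Y) :* E) :* E) := (:- Y) :* (E :* E)) S.refl X inv1+X ⟩
    (-S X) *S (inv1+X *S inv1+X) ∎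
    where
    open ≐-Reasoning
    open NS.Solver

  pow-ev-uPoly-inv1+X : ∀ j → OS.pow ((-S X) *S (inv1+X *S inv1+X)) j ≐ constS (sgn j) *S (OS.pow X j *S OS.pow inv1+X (j ℕ.+ j))
  pow-ev-uPoly-inv1+X zero    = S.sym (S.trans (S.*-identityˡ _) (S.*-identityˡ _))
  pow-ev-uPoly-inv1+X (suc j) = begin
    ((-S X) *S (e *S e)) *S OS.pow ((-S X) *S (e *S e)) j
      ≈⟨ *S-congˡ ((-S X) *S (e *S e)) (pow-ev-uPoly-inv1+X j) ⟩
    ((-S X) *S (e *S e)) *S (constS (sgn j) *S (OS.pow X j *S OS.pow e (j ℕ.+ j)))
      ≈⟨ solve 5 (λ Y E s P Q → ((:- Y) :* (E :* E)) :* (s :* (P :* Q))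
                             := ((:- con (+ 1)) :* s) :* ((Y :* P) :* (E :* (E :* Q))))
                 S.refl X e (constS (sgn j)) (OS.pow X j) (OS.pow e (j ℕ.+ j)) ⟩
    ((-S 1S) *S constS (sgn j)) *S (OS.pow X (suc j) *S OS.pow e (suc (suc (j ℕ.+ j))))
      ≈⟨ S.*-cong (S.trans (*S-congʳ (constS (sgn j)) (S.sym (constS-neg 1#))) (S.sym (constS-* (- 1#) (sgn j))))
                  (*S-congˡ (OS.pow X (suc j)) (S.reflexive (P.cong (λ m → OS.pow e (suc m)) (P.sym (ℕP.+-suc j j))))) ⟩
    constS (sgn (suc j)) *S (OS.pow X (suc j) *S OS.pow e (suc j ℕ.+ suc j)) ∎
    where
    open ≐-Reasoning
    open NS.Solver
    e : FPS
    e = inv1+X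

  kernel : ℕ → ℕ → FPS
  kernel k j = 1-X *S binomSeries (+ (2 ℕ.* k) ℤ.- + suc (j ℕ.+ j))

  kernel-exponent : ∀ k j → j ≤ k → + (2 ℕ.* k) ℤ.- + suc (j ℕ.+ j) ≡ ((k ∸ j) ℕ.+ (k ∸ j)) ℤ.⊖ 1
  kernel-exponent k j j≤k = P.trans (ℤP.m-n≡m⊖n (2 ℕ.* k) (suc (j ℕ.+ j)))
    (P.trans (P.cong₂ ℤ._⊖_ 2k≡2j+2m 1+2j≡2j+1) (ℤP.+-cancelˡ-⊖ (j ℕ.+ j) _ 1))
    where
    m : ℕ
    m = k ∸ j
    2k≡2j+2m : 2 ℕ.* k ≡ (j ℕ.+ j) ℕ.+ (m ℕ.+ m)
    2k≡2j+2m = P.trans (P.cong (2 ℕ.*_) (P.sym (ℕP.m+[n∸m]≡n j≤k)))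
      (+-*-Solver.solve 2 (λ J M → +-*-Solver.con 2 +-*-Solver.:* (J +-*-Solver.:+ M)
                             +-*-Solver.:= (J +-*-Solver.:+ J) +-*-Solver.:+ (M +-*-Solver.:+ M)) P.refl j m)
    1+2j≡2j+1 : suc (j ℕ.+ j) ≡ (j ℕ.+ j) ℕ.+ 1
    1+2j≡2j+1 = ℕP.+-comm 1 (j ℕ.+ j)

  -- [x^m] (1 - x)(1 + x)^(2m - 1) = binom(2m-1, m) - binom(2m-1, m-1), which is 0 for m ≥ 1 and 1 for m = 0.
  kernel-< : ∀ k j → j < k → kernel k j (k ∸ j) ≈ 0#
  kernel-< k j j<k = trans (reflexive (P.cong (λ e → (1-X *S binomSeries e) (k ∸ j)) (kernel-exponent k j (ℕP.<⇒≤ j<k))))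
    (vanish (k ∸ j) (k∸j≡1+[k∸1+j] k j<k))
    where
    k∸j≡1+[k∸1+j] : ∀ k {j} → j < k → k ∸ j ≡ suc (k ∸ suc j)
    k∸j≡1+[k∸1+j] (suc k) (s≤s j≤k) = ℕP.+-∸-assoc 1 j≤k
    vanish : ∀ m {m′} → m ≡ suc m′ → (1-X *S binomSeries ((m ℕ.+ m) ℤ.⊖ 1)) m ≈ 0#
    vanish .(suc m′) {m′} P.refl = begin
      (1-X *S binomSeries (+ N)) (suc m′)
        ≈⟨ 1-X*S-suc (binomSeries (+ N)) m′ ⟩
      fromℕ (N C suc m′) - fromℕ (N C m′)
        ≡⟨ P.cong (λ z → fromℕ z - fromℕ (N C m′))
                  (P.trans (nCk≡nC[n∸k] (ℕP.m≤n+m (suc m′) m′)) (P.cong (N C_) (ℕP.m+n∸n≡m m′ (suc m′)))) ⟩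
      fromℕ (N C m′) - fromℕ (N C m′)
        ≈⟨ -‿inverseʳ _ ⟩
      0# ∎
      where
      open ≈-Reasoning
      N : ℕ
      N = m′ ℕ.+ suc m′

  kernel-≡ : ∀ k → kernel k k (k ∸ k) ≈ 1#
  kernel-≡ k = trans (reflexive (P.cong (λ e → (1-X *S binomSeries e) (k ∸ k)) (kernel-exponent k k ℕP.≤-refl)))
    (at-zero (k ∸ k) (ℕP.n∸n≡0 k))
    where
    at-zero : ∀ m → m ≡ 0 → (1-X *S binomSeries ((m ℕ.+ m) ℤ.⊖ 1)) m ≈ 1#
    at-zero .0 P.refl = trans (1-X*S-zero (binomSeries -[1+ 0 ])) (binomSeries-coeff-0 -[1+ 0 ])

  U : FPS
  U = (-S X) *S (inv1+X *S inv1+X)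

  term : ℕ → ℕ → FPS
  term k j = constS (coeff F j) *S (constS (sgn j) *S (OS.pow X j *S kernel k j))

  binomSeries*factor : ∀ k j → binomSeries (+ (2 ℕ.* k)) *S ((1-X *S inv1+X) *S (constS (coeff F j) *S OS.pow U j)) ≐ term k j
  binomSeries*factor k j = begin
    E *S ((1-X *S e) *S (f *S OS.pow U j))
      ≈⟨ *S-congˡ E (*S-congˡ (1-X *S e) (*S-congˡ f (pow-ev-uPoly-inv1+X j))) ⟩
    E *S ((1-X *S e) *S (f *S (s *S (OS.pow X j *S OS.pow e (j ℕ.+ j)))))
      ≈⟨ solve 7 (λ Ek O e c s P Q → Ek :* ((O :* e) :* (c :* (s :* (P :* Q))))
                                  := c :* (s :* (P :* (O :* (Ek :* (e :* Q))))))
                 S.refl E 1-X e f s (OS.pow X j) (OS.pow e (j ℕ.+ j)) ⟩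
    f *S (s *S (OS.pow X j *S (1-X *S (E *S (e *S OS.pow e (j ℕ.+ j))))))
      ≈⟨ *S-congˡ f (*S-congˡ s (*S-congˡ (OS.pow X j) (*S-congˡ 1-X (binomSeries*inv1+X^ (+ (2 ℕ.* k)) (suc (j ℕ.+ j)))))) ⟩
    term k j ∎
    where
    open ≐-Reasoning
    open NS.Solver
    E e f s : FPS
    E = binomSeries (+ (2 ℕ.* k))
    e = inv1+X
    f = constS (coeff F j)
    s = constS (sgn j)

  Cser-as-sum : ∀ k → Cser α n (+ (2 ℕ.* k)) ≐ OS.sumTo (length F) (term k)
  Cser-as-sum k = begin
    Cser α n (+ (2 ℕ.* k))
      ≈⟨ Cser-as-substitution (+ (2 ℕ.* k)) ⟩
    E *S ev A inv1+X
      ≈⟨ *S-congˡ E (ev-A-factorisation inv1+X) ⟩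
    E *S (ev twoXminus1 inv1+X *S ev F (ev uPoly inv1+X))
      ≈⟨ *S-congˡ E (S.*-cong ev-twoXminus1-inv1+X (ev-congʳ F ev-uPoly-inv1+X)) ⟩
    E *S ((1-X *S inv1+X) *S ev F U)
      ≈⟨ *S-congˡ E (*S-congˡ (1-X *S inv1+X) (ev-as-sum F (length F) U F-vanishes)) ⟩
    E *S ((1-X *S inv1+X) *S OS.sumTo (length F) (λ j → constS (coeff F j) *S OS.pow U j))
      ≈⟨ S.trans (*S-congˡ E (FS.sumTo-*ˡ (length F) (1-X *S inv1+X) _)) (FS.sumTo-*ˡ (length F) E _) ⟩
    OS.sumTo (length F) (λ j → E *S ((1-X *S inv1+X) *S (constS (coeff F j) *S OS.pow U j)))
      ≈⟨ FS.sumTo-cong (length F) (binomSeries*factor k) ⟩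
    OS.sumTo (length F) (term k) ∎
    where
    open ≐-Reasoning
    E : FPS
    E = binomSeries (+ (2 ℕ.* k))
    F-vanishes : ∀ j → length F < j → coeff F j ≈ 0#
    F-vanishes j L<j = reflexive (coeff-≥length F j (ℕP.<⇒≤ L<j))

  term-coeff : ∀ k j i → term k j i ≈ coeff F j * (sgn j * (OS.pow X j *S kernel k j) i)
  term-coeff k j i = trans (constS-*S (coeff F j) (constS (sgn j) *S (OS.pow X j *S kernel k j)) i)
                           (*-congˡ (constS-*S (sgn j) (OS.pow X j *S kernel k j) i))

  term-coeff-< : ∀ k j → j < k → term k j k ≈ 0#
  term-coeff-< k j j<k = trans (term-coeff k j k)
    (trans (*-congˡ (*-congˡ (trans (X^j*S-≤ j (kernel k j) k (ℕP.<⇒≤ j<k)) (kernel-< k j j<k))))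
    (trans (*-congˡ (zeroʳ _)) (zeroʳ _)))

  term-coeff-> : ∀ k j → k < j → term k j k ≈ 0#
  term-coeff-> k j k<j = trans (term-coeff k j k)
    (trans (*-congˡ (*-congˡ (X^j*S-< j (kernel k j) k k<j))) (trans (*-congˡ (zeroʳ _)) (zeroʳ _)))

  term-coeff-≡ : ∀ k → term k k k ≈ sgn k * coeff F k
  term-coeff-≡ k = trans (term-coeff k k k)
    (trans (*-congˡ (*-congˡ (trans (X^j*S-≤ k (kernel k k) k ℕP.≤-refl) (kernel-≡ k))))
    (trans (*-congˡ (*-identityʳ _)) (*-comm _ _)))

  sgn*coeff-F≈Cser : ∀ k → sgn k * coeff F k ≈ Cser α n (+ (2 ℕ.* k)) k
  sgn*coeff-F≈Cser k = sym (trans (Cser-as-sum k k) (trans (sumToS-coeff (length F) (term k) k) (pick (k ℕP.≤? length F))))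
    where
    pick : Dec (k ≤ length F) → sumTo (length F) (λ j → term k j k) ≈ sgn k * coeff F k
    pick (yes k≤L) = trans (sumTo-single (length F) (λ j → term k j k) k k≤L (λ t _ t≢k → off-diagonal t t≢k))
                           (term-coeff-≡ k)
      where
      off-diagonal : ∀ t → t ≢ k → term k t k ≈ 0#
      off-diagonal t t≢k with ℕP.<-cmp t k
      ... | tri< t<k _ _ = term-coeff-< k t t<k
      ... | tri≈ _ t≡k _ = ⊥-elim (t≢k t≡k)
      ... | tri> _ _ k<t = term-coeff-> k t k<t
    pick (no k≰L) = trans (sumTo-zero (length F) _ (λ t t≤L → term-coeff-< k t (ℕP.≤-<-trans t≤L (ℕP.≰⇒> k≰L))))
      (sym (trans (*-congˡ (reflexive (coeff-≥length F k (ℕP.<⇒≤ (ℕP.≰⇒> k≰L))))) (zeroʳ _)))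

  ev-A-inv1+X-A-reflection : ev A inv1+X ≐ -S ev A (X *S inv1+X)
  ev-A-inv1+X-A-reflection = ev-A-A-reflection (X *S inv1+X) inv1+X
    (S.trans (solve 2 (λ x e → x :* e :+ e := (con (+ 1) :+ con (+ 1) :* x) :* e) S.refl X inv1+X) 1+X*inv1+X)
    where open NS.Solver

  Cser-coeff : ∀ j i → Cser α n j i ≈ sumTo n (λ μ → Acoeff μ * binomSeries (j ℤ.- + μ) i)
  Cser-coeff j i = trans (Cser-as-substitution j i) (binomSeries*ev-A-inv1+X j i)

  Cser-coeff-reflected : ∀ j i → Cser α n j i ≈ - sumTo n (λ μ → Acoeff μ * (OS.pow X μ *S binomSeries (j ℤ.- + μ)) i)
  Cser-coeff-reflected j i = begin
    Cser α n j i                                  ≈⟨ Cser-as-substitution j i ⟩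
    (binomSeries j *S ev A inv1+X) i              ≈⟨ *S-congˡ (binomSeries j) ev-A-inv1+X-A-reflection i ⟩
    (binomSeries j *S (-S ev A (X *S inv1+X))) i  ≈⟨ sym (NS.-‿distribʳ-* (binomSeries j) (ev A (X *S inv1+X)) i) ⟩
    - (binomSeries j *S ev A (X *S inv1+X)) i     ≈⟨ -‿cong (trans (binomSeries*ev-A j (X *S inv1+X) i) (sumToS-coeff n _ i)) ⟩
    - sumTo n (λ μ → (constS (Acoeff μ) *S (binomSeries j *S OS.pow (X *S inv1+X) μ)) i)
      ≈⟨ -‿cong (sumTo-cong n (λ μ → trans (constS-*S (Acoeff μ) (binomSeries j *S OS.pow (X *S inv1+X) μ) i)
                                           (*-congˡ (shift μ i)))) ⟩
    - sumTo n (λ μ → Acoeff μ * (OS.pow X μ *S binomSeries (j ℤ.- + μ)) i) ∎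
    where
    open ≈-Reasoning
    open CommSemigroupProperties S.*-commutativeSemigroup using (x∙yz≈y∙xz)
    shift : ∀ μ → binomSeries j *S OS.pow (X *S inv1+X) μ ≐ OS.pow X μ *S binomSeries (j ℤ.- + μ)
    shift μ = S.trans (*S-congˡ (binomSeries j) (NS.pow-distrib-* X inv1+X μ))
      (S.trans (x∙yz≈y∙xz (binomSeries j) (OS.pow X μ) (OS.pow inv1+X μ))
               (*S-congˡ (OS.pow X μ) (binomSeries*inv1+X^ j μ)))

  coeff-F≈sgn*Cser : ∀ k → coeff F k ≈ sgn k * Cser α n (+ (2 ℕ.* k)) k
  coeff-F≈sgn*Cser k = begin
    coeff F k                         ≈⟨ sym (trans (*-congʳ (sgn-involutive k)) (*-identityˡ _)) ⟩
    (sgn k * sgn k) * coeff F k       ≈⟨ trans (*-assoc _ _ _) (*-congˡ (sgn*coeff-F≈Cser k)) ⟩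
    sgn k * Cser α n (+ (2 ℕ.* k)) k  ∎
    where open ≈-Reasoning

  coeff-F-binomial : ∀ k → k ≤ n → coeff F k ≈ sgn (suc k) * sumTo k (λ ν → fromℕ ((2 ℕ.* k ∸ ν) C k) * Acoeff ν)
  coeff-F-binomial k k≤n = begin
    coeff F k                        ≈⟨ coeff-F≈sgn*Cser k ⟩
    sgn k * Cser α n (+ (2 ℕ.* k)) k ≈⟨ *-congˡ (Cser-coeff-reflected (+ (2 ℕ.* k)) k) ⟩
    sgn k * - sumTo n g              ≈⟨ *-congˡ (-‿cong (sumTo-truncate n k g k≤n high-vanish)) ⟩
    sgn k * - sumTo k g              ≈⟨ trans (sym (-‿distribʳ-* _ _)) (trans (-‿distribˡ-* _ _) (*-congʳ (sym (sgn-suc k)))) ⟩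
    sgn (suc k) * sumTo k g          ≈⟨ *-congˡ (sumTo-cong-≤ k low) ⟩
    sgn (suc k) * sumTo k (λ ν → fromℕ ((2 ℕ.* k ∸ ν) C k) * Acoeff ν) ∎
    where
    open ≈-Reasoning
    g : ℕ → Carrier
    g μ = Acoeff μ * (OS.pow X μ *S binomSeries (+ (2 ℕ.* k) ℤ.- + μ)) k
    high-vanish : ∀ t → k < t → t ≤ n → g t ≈ 0#
    high-vanish t k<t _ = trans (*-congˡ (X^j*S-< t (binomSeries (+ (2 ℕ.* k) ℤ.- + t)) k k<t)) (zeroʳ _)
    k≤2k : k ≤ 2 ℕ.* k
    k≤2k = ℕP.m≤m+n k (k ℕ.+ 0)
    low : ∀ μ → μ ≤ k → g μ ≈ fromℕ ((2 ℕ.* k ∸ μ) C k) * Acoeff μ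
    low μ μ≤k = begin
      Acoeff μ * (OS.pow X μ *S binomSeries (+ (2 ℕ.* k) ℤ.- + μ)) k
        ≈⟨ *-congˡ (X^j*S-≤ μ (binomSeries (+ (2 ℕ.* k) ℤ.- + μ)) k μ≤k) ⟩
      Acoeff μ * binomSeries (+ (2 ℕ.* k) ℤ.- + μ) (k ∸ μ)
        ≡⟨ P.cong (λ e → Acoeff μ * binomSeries e (k ∸ μ)) (+m-+n≡+[m∸n] (ℕP.≤-trans μ≤k k≤2k)) ⟩
      Acoeff μ * fromℕ ((2 ℕ.* k ∸ μ) C (k ∸ μ))
        ≡⟨ P.cong (λ z → Acoeff μ * fromℕ z) (P.trans (nCk≡nC[n∸k] (ℕP.∸-monoˡ-≤ μ k≤2k)) (P.cong ((2 ℕ.* k ∸ μ) C_) 2k∸μ∸[k∸μ]≡k)) ⟩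
      Acoeff μ * fromℕ ((2 ℕ.* k ∸ μ) C k)
        ≈⟨ *-comm _ _ ⟩
      fromℕ ((2 ℕ.* k ∸ μ) C k) * Acoeff μ ∎
      where
      2k∸μ∸[k∸μ]≡k : 2 ℕ.* k ∸ μ ∸ (k ∸ μ) ≡ k
      2k∸μ∸[k∸μ]≡k = P.trans (P.cong (λ z → k ℕ.+ z ∸ μ ∸ (k ∸ μ)) (ℕP.+-identityʳ k))
        (P.trans (P.cong (_∸ (k ∸ μ)) (ℕP.+-∸-assoc k μ≤k)) (ℕP.m+n∸n≡m k (k ∸ μ)))

  coeff-F-aCoef : ∀ k → k ≤ n →
                  coeff F k ≈ sgn k * sumTo k (λ ν → fromℤ (gbinom (+ (2 ℕ.* k) ℤ.- + n) (k ∸ ν)) * aCoef α n ν)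
  coeff-F-aCoef k k≤n = trans (coeff-F≈sgn*Cser k) (*-congˡ (sumTo-cong-≤ k (λ t t≤k →
    trans (*-congʳ (reflexive (coeff-applyUpTo-< (aCoef α n) (suc n) t (s≤s (ℕP.≤-trans t≤k k≤n))))) (*-comm _ _))))

  module CserPolynomial (N : ℕ) (n≤N : n ≤ N) where

    binomSeries-N-μ : ∀ μ i → μ ≤ n → binomSeries (+ N ℤ.- + μ) i ≈ fromℕ ((N ∸ μ) C i)
    binomSeries-N-μ μ i μ≤n = reflexive (P.cong (λ e → binomSeries e i) (+m-+n≡+[m∸n] (ℕP.≤-trans μ≤n n≤N)))

    Cser-vanishes : ∀ i → N < i → Cser α n (+ N) i ≈ 0#
    Cser-vanishes i N<i = trans (Cser-coeff (+ N) i) (sumTo-zero n _ (λ μ μ≤n → trans (*-congˡ (trans (binomSeries-N-μ μ i μ≤n)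
      (reflexive (P.cong fromℕ (k>n⇒nCk≡0 (ℕP.≤-<-trans (ℕP.m∸n≤m N μ) N<i)))))) (zeroʳ _)))

    shifted-coeff : ∀ i μ → i ≤ N → μ ≤ n →
                    (OS.pow X μ *S binomSeries (+ N ℤ.- + μ)) i ≈ fromℕ ((N ∸ μ) C (N ∸ i))
    shifted-coeff i μ i≤N μ≤n with μ ℕP.≤? i
    ... | yes μ≤i = trans (X^j*S-≤ μ (binomSeries (+ N ℤ.- + μ)) i μ≤i) (trans (binomSeries-N-μ μ (i ∸ μ) μ≤n)
          (reflexive (P.cong fromℕ (P.trans (nCk≡nC[n∸k] (ℕP.∸-monoˡ-≤ μ i≤N)) (P.cong ((N ∸ μ) C_) N∸μ∸[i∸μ]≡N∸i)))))
      where
      N∸μ∸[i∸μ]≡N∸i : N ∸ μ ∸ (i ∸ μ) ≡ N ∸ i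
      N∸μ∸[i∸μ]≡N∸i = P.trans (ℕP.∸-+-assoc N μ (i ∸ μ)) (P.cong (N ∸_) (ℕP.m+[n∸m]≡n μ≤i))
    ... | no μ≰i = trans (X^j*S-< μ (binomSeries (+ N ℤ.- + μ)) i (ℕP.≰⇒> μ≰i))
          (sym (reflexive (P.cong fromℕ (k>n⇒nCk≡0 (ℕP.∸-monoʳ-< (ℕP.≰⇒> μ≰i) (ℕP.≤-trans μ≤n n≤N))))))

    Cser-antipalindromic : ∀ i → i ≤ N → Cser α n (+ N) i ≈ - Cser α n (+ N) (N ∸ i)
    Cser-antipalindromic i i≤N = trans (Cser-coeff-reflected (+ N) i)
      (-‿cong (trans (sumTo-cong-≤ n (λ μ μ≤n → *-congˡ (shifted-coeff i μ i≤N μ≤n)))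
      (sym (trans (Cser-coeff (+ N) (N ∸ i)) (sumTo-cong-≤ n (λ μ μ≤n → *-congˡ (binomSeries-N-μ μ (N ∸ i) μ≤n)))))))

  n<2k : ∀ k → d < k → n < 2 ℕ.* k
  n<2k k d<k = P.subst (_< 2 ℕ.* k) (P.sym n≡1+2d) (ℕP.<-≤-trans (s≤s (ℕP.+-monoʳ-< d d<k))
    (ℕP.≤-trans (ℕP.+-monoˡ-≤ k d<k) (ℕP.≤-reflexive (P.cong (k ℕ.+_) (P.sym (ℕP.+-identityʳ k))))))

  Cser-polynomial-antipalindromic : ∀ k → d < k → IsPolynomial (Cser α n (+ (2 ℕ.* k)))
                                                 × AntiPalindromic (2 ℕ.* k) (Cser α n (+ (2 ℕ.* k)))
  Cser-polynomial-antipalindromic k d<k = (suc (2 ℕ.* k) , Cser-vanishes) , (Cser-vanishes , Cser-antipalindromic)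
    where open CserPolynomial (2 ℕ.* k) (ℕP.<⇒≤ (n<2k k d<k))

  coeff-F-vanishes : ∀ k → d < k → coeff F k ≈ 0#
  coeff-F-vanishes k d<k = trans (coeff-F≈sgn*Cser k) (trans (*-congˡ middle-vanishes) (zeroʳ _))
    where
    open CserPolynomial (2 ℕ.* k) (ℕP.<⇒≤ (n<2k k d<k))
    2k∸k≡k : 2 ℕ.* k ∸ k ≡ k
    2k∸k≡k = P.trans (P.cong (λ z → (k ℕ.+ z) ∸ k) (ℕP.+-identityʳ k)) (ℕP.m+n∸m≡n k k)
    middle-vanishes : Cser α n (+ (2 ℕ.* k)) k ≈ 0#
    middle-vanishes = x≈-x⇒x≈0 (trans (Cser-antipalindromic k (ℕP.m≤m+n k (k ℕ.+ 0)))
      (reflexive (P.cong (λ z → - Cser α n (+ (2 ℕ.* k)) z) 2k∸k≡k)))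

  k!*Cser≈derivative-G : ∀ j k → fromℕ (k !) * Cser α n j k ≈ evalL 1# 1# (derivLⁿ k (G α n j))
  k!*Cser≈derivative-G j k = begin
    fromℕ (k !) * Cser α n j k                                        ≈⟨ *-congˡ (Cser-coeff j k) ⟩
    fromℕ (k !) * sumTo n (λ μ → Acoeff μ * binomSeries (j ℤ.- + μ) k) ≈⟨ trans (sumTo-*ˡ n _ _) (sumTo-cong n termwise) ⟩
    sumTo n (λ μ → fromℤ (ffall (j ℤ.- + μ) k) * Acoeff μ)             ≈⟨ sym (fallingSum-applyUpTo k n _) ⟩
    fallingSum k (G α n j)                                            ≈⟨ sym (evalL-1-derivLⁿ k _) ⟩
    evalL 1# 1# (derivLⁿ k (G α n j))                                 ∎
    where
    open ≈-Reasoning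
    open Solver
    termwise : ∀ μ → fromℕ (k !) * (Acoeff μ * binomSeries (j ℤ.- + μ) k) ≈ fromℤ (ffall (j ℤ.- + μ) k) * Acoeff μ
    termwise μ = trans (solve 3 (λ f a b → f :* (a :* b) := (f :* b) :* a) refl (fromℕ (k !)) (Acoeff μ) _)
                   (*-congʳ (k!*gbinom≈ffall k (j ℤ.- + μ)))

  u : FPS
  u = ev uPoly X

  u-degree : HasDegree≤ 2 u
  u-degree (suc zero)          (s≤s ())
  u-degree (suc (suc zero))    (s≤s (s≤s ()))
  u-degree (suc (suc (suc i))) _ = ev-X uPoly (suc (suc (suc i)))

  u^-degree : ∀ j → HasDegree≤ (j ℕ.+ j) (OS.pow u j)
  u^-degree zero    (suc i) _ = refl
  u^-degree (suc j) = P.subst (λ m → HasDegree≤ m (OS.pow u (suc j))) (P.cong suc (P.sym (ℕP.+-suc j j)))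
                              (*S-degree 2 (j ℕ.+ j) u _ u-degree (u^-degree j))

  u^-top : ∀ j → OS.pow u j (j ℕ.+ j) ≈ 1#
  u^-top zero    = refl
  u^-top (suc j) = begin
    OS.pow u (suc j) (suc (j ℕ.+ suc j))     ≡⟨ P.cong (OS.pow u (suc j)) (P.cong suc (ℕP.+-suc j j)) ⟩
    (u *S OS.pow u j) (2 ℕ.+ (j ℕ.+ j))      ≈⟨ *S-top-coeff 2 (j ℕ.+ j) u _ u-degree (u^-degree j) ⟩
    u 2 * OS.pow u j (j ℕ.+ j)               ≈⟨ trans (*-cong (ev-X uPoly 2) (u^-top j)) (*-identityˡ 1#) ⟩
    1#                                       ∎
    where open ≈-Reasoning

  F∘u-partial : ℕ → FPS
  F∘u-partial m = OS.sumTo m (λ j → constS (coeff F j) *S OS.pow u j)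

  F∘u-partial-degree : ∀ m → HasDegree≤ (m ℕ.+ m) (F∘u-partial m)
  F∘u-partial-degree zero    = *S-degree 0 0 _ _ (constS-degree _) (u^-degree 0)
  F∘u-partial-degree (suc m) = +S-degree _ _ _ (HasDegree≤-mono _ 2m≤2+2m (F∘u-partial-degree m))
                                              (*S-degree 0 _ _ _ (constS-degree _) (u^-degree (suc m)))
    where
    2m≤2+2m : m ℕ.+ m ≤ suc m ℕ.+ suc m
    2m≤2+2m = ℕP.≤-trans (ℕP.m≤n+m (m ℕ.+ m) 2) (ℕP.≤-reflexive (P.cong suc (P.sym (ℕP.+-suc m m))))

  F∘u-partial-top : ∀ m → F∘u-partial m (m ℕ.+ m) ≈ coeff F m
  F∘u-partial-top m = trans (top-of-sum m) (trans (*S-top-coeff 0 (m ℕ.+ m) _ _ (constS-degree _) (u^-degree m))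
                                                  (trans (*-congˡ (u^-top m)) (*-identityʳ _)))
    where
    top-of-sum : ∀ m → F∘u-partial m (m ℕ.+ m) ≈ (constS (coeff F m) *S OS.pow u m) (m ℕ.+ m)
    top-of-sum zero    = refl
    top-of-sum (suc m) = trans (+-congʳ (F∘u-partial-degree m _ 2m<2+2m)) (+-identityˡ _)
      where
      2m<2+2m : m ℕ.+ m < suc m ℕ.+ suc m
      2m<2+2m = ℕP.≤-trans (ℕP.n<1+n (m ℕ.+ m))
                  (ℕP.≤-trans (ℕP.n≤1+n _) (ℕP.≤-reflexive (P.cong suc (P.sym (ℕP.+-suc m m)))))

  twoXminus1-degree : HasDegree≤ 1 (ev twoXminus1 X)
  twoXminus1-degree (suc zero)    (s≤s ())
  twoXminus1-degree (suc (suc i)) _ = ev-X twoXminus1 (suc (suc i))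

  -- A_n = (2x - 1) F(x(x - 1)) with deg F ≤ d; compare the coefficients of x^n = x^(2d+1).
  two*coeff-F-top : fromℕ 2 * coeff F d ≈ α 0
  two*coeff-F-top = begin
    fromℕ 2 * coeff F d
      ≈⟨ *-cong (sym (ev-X twoXminus1 1)) (sym (F∘u-partial-top d)) ⟩
    ev twoXminus1 X 1 * F∘u-partial d (d ℕ.+ d)
      ≈⟨ sym (*S-top-coeff 1 (d ℕ.+ d) _ _ twoXminus1-degree (F∘u-partial-degree d)) ⟩
    (ev twoXminus1 X *S F∘u-partial d) (suc (d ℕ.+ d))
      ≈⟨ sym (*S-congˡ (ev twoXminus1 X) (ev-as-sum F d u coeff-F-vanishes) (suc (d ℕ.+ d))) ⟩
    (ev twoXminus1 X *S ev F u) (suc (d ℕ.+ d))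
      ≈⟨ sym (ev-A-factorisation X (suc (d ℕ.+ d))) ⟩
    ev A X (suc (d ℕ.+ d))
      ≈⟨ ev-X A (suc (d ℕ.+ d)) ⟩
    coeff A (suc (d ℕ.+ d))
      ≡⟨ P.cong (coeff A) (P.sym n≡1+2d) ⟩
    coeff A n
      ≡⟨ coeff-applyUpTo-< Acoeff (suc n) n ℕP.≤-refl ⟩
    fromℕ (n C n) * α (n ∸ n)
      ≡⟨ P.cong₂ (λ x y → fromℕ x * α y) (nCn≡1 n) (ℕP.n∸n≡0 n) ⟩
    fromℕ 1 * α 0
      ≈⟨ trans (*-congʳ (+-identityʳ 1#)) (*-identityˡ _) ⟩
    α 0 ∎
    where open ≈-Reasoning

  derivP-Appell : ∀ m → derivP (Appell α (suc m)) ≋ scaleP (fromℕ (suc m)) (Appell α m)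
  derivP-Appell m i = trans (coeff-derivP (Appell α (suc m)) i)
                            (trans (compare (i ℕP.≤? m)) (sym (coeff-scaleP (fromℕ (suc m)) (Appell α m) i)))
    where
    compare : Dec (i ≤ m) → fromℕ (suc i) * coeff (Appell α (suc m)) (suc i) ≈ fromℕ (suc m) * coeff (Appell α m) i
    compare (yes i≤m) = begin
      fromℕ (suc i) * coeff (Appell α (suc m)) (suc i)
        ≡⟨ P.cong (fromℕ (suc i) *_) (coeff-applyUpTo-< (appellCoeff (suc m)) (suc (suc m)) (suc i) (s≤s (s≤s i≤m))) ⟩
      fromℕ (suc i) * (fromℕ (suc m C suc i) * α (m ∸ i))
        ≈⟨ trans (sym (*-assoc _ _ _)) (*-congʳ (sym (fromℕ-* (suc i) (suc m C suc i)))) ⟩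
      fromℕ (suc i ℕ.* (suc m C suc i)) * α (m ∸ i)
        ≡⟨ P.cong (λ z → fromℕ z * α (m ∸ i)) (BinomialCoefficients.absorption m i) ⟩
      fromℕ (suc m ℕ.* (m C i)) * α (m ∸ i)
        ≈⟨ trans (*-congʳ (fromℕ-* (suc m) (m C i))) (*-assoc _ _ _) ⟩
      fromℕ (suc m) * (fromℕ (m C i) * α (m ∸ i))
        ≡⟨ P.cong (fromℕ (suc m) *_) (P.sym (coeff-applyUpTo-< (appellCoeff m) (suc m) i (s≤s i≤m))) ⟩
      fromℕ (suc m) * coeff (Appell α m) i ∎
      where open ≈-Reasoning
    compare (no i≰m) = begin
      fromℕ (suc i) * coeff (Appell α (suc m)) (suc i)
        ≡⟨ P.cong (fromℕ (suc i) *_) (coeff-applyUpTo-≥ (appellCoeff (suc m)) (suc (suc m)) (suc i) (s≤s (ℕP.≰⇒> i≰m))) ⟩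
      fromℕ (suc i) * 0#
        ≈⟨ trans (zeroʳ _) (sym (zeroʳ _)) ⟩
      fromℕ (suc m) * 0#
        ≡⟨ P.cong (fromℕ (suc m) *_) (P.sym (coeff-applyUpTo-≥ (appellCoeff m) (suc m) i (ℕP.≰⇒> i≰m))) ⟩
      fromℕ (suc m) * coeff (Appell α m) i ∎
      where open ≈-Reasoning

  -- The even companion A_(n+1) = F₁(x(x - 1))

  ≋-from-derivP : ∀ p q → coeff p 0 ≈ coeff q 0 → derivP p ≋ derivP q → p ≋ q
  ≋-from-derivP p q p₀≈q₀ p′≋q′ zero    = p₀≈q₀
  ≋-from-derivP p q p₀≈q₀ p′≋q′ (suc i) = fromℕ-suc-cancel i
    (trans (sym (coeff-derivP p i)) (trans (p′≋q′ i) (coeff-derivP q i)))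

  -- a ∷ antiderivative 0 p is a + ∫₀ˣ p (recall that inverse m is 1/(m + 1))
  antiderivative : ℕ → Poly → Poly
  antiderivative i []      = []
  antiderivative i (a ∷ p) = (inverse i * a) ∷ antiderivative (suc i) p

  coeff-antiderivative : ∀ i p j → coeff (antiderivative i p) j ≈ inverse (i ℕ.+ j) * coeff p j
  coeff-antiderivative i []      j       = sym (zeroʳ _)
  coeff-antiderivative i (a ∷ p) zero    = reflexive (P.cong (λ z → inverse z * a) (P.sym (ℕP.+-identityʳ i)))
  coeff-antiderivative i (a ∷ p) (suc j) = trans (coeff-antiderivative (suc i) p j)
    (reflexive (P.cong (λ z → inverse z * coeff p j) (P.sym (ℕP.+-suc i j))))

  derivP-antiderivative : ∀ a p → derivP (a ∷ antiderivative 0 p) ≋ p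
  derivP-antiderivative a p j = begin
    coeff (derivP (a ∷ antiderivative 0 p)) j        ≈⟨ coeff-derivP (a ∷ antiderivative 0 p) j ⟩
    fromℕ (suc j) * coeff (antiderivative 0 p) j     ≈⟨ *-congˡ (coeff-antiderivative 0 p j) ⟩
    fromℕ (suc j) * (inverse j * coeff p j)          ≈⟨ trans (sym (*-assoc _ _ _)) (*-congʳ (inverse-correct j)) ⟩
    1# * coeff p j                                   ≈⟨ *-identityˡ _ ⟩
    coeff p j                                        ∎
    where open ≈-Reasoning

  F₁ : Poly
  F₁ = α (suc n) ∷ antiderivative 0 (scaleP (fromℕ (suc n)) F)

  derivP-uPoly : derivP uPoly ≋ twoXminus1
  derivP-uPoly zero                = trans (coeff-derivP uPoly 0) (trans (*-congʳ (+-identityʳ 1#)) (*-identityˡ _))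
  derivP-uPoly (suc zero)          = trans (coeff-derivP uPoly 1) (*-identityʳ _)
  derivP-uPoly (suc (suc i))       = trans (coeff-derivP uPoly (suc (suc i))) (zeroʳ _)

  derivP-F₁ : derivP F₁ ≋ scaleP (fromℕ (suc n)) F
  derivP-F₁ = derivP-antiderivative (α (suc n)) (scaleP (fromℕ (suc n)) F)

  -- (F₁ ∘ u)′ = u′ · F₁′(u) = (2x - 1) · (n + 1) F(u) = (n + 1) A_n = A_(n+1)′
  derivP-agree : ev (derivP (Appell α (suc n))) X ≐ ev (derivP (F₁ ∘P uPoly)) X
  derivP-agree = begin
    ev (derivP (Appell α (suc n))) X
      ≈⟨ ev-cong (derivP (Appell α (suc n))) (scaleP n+1 A) X (derivP-Appell n) ⟩
    ev (scaleP n+1 A) X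
      ≈⟨ S.trans (ev-scaleP n+1 A X) (*S-congˡ (constS n+1) (ev-A-factorisation X)) ⟩
    constS n+1 *S (ev twoXminus1 X *S ev F u)
      ≈⟨ x∙yz≈y∙xz (constS n+1) (ev twoXminus1 X) (ev F u) ⟩
    ev twoXminus1 X *S (constS n+1 *S ev F u)
      ≈⟨ S.sym (S.*-cong (ev-cong (derivP uPoly) twoXminus1 X derivP-uPoly)
                         (S.trans (ev-cong (derivP F₁) (scaleP n+1 F) u derivP-F₁) (ev-scaleP n+1 F u))) ⟩
    ev (derivP uPoly) X *S ev (derivP F₁) u
      ≈⟨ S.sym (ev-derivP-∘P F₁ uPoly X) ⟩
    ev (derivP (F₁ ∘P uPoly)) X ∎
    where
    open ≐-Reasoning
    open CommSemigroupProperties S.*-commutativeSemigroup using (x∙yz≈y∙xz)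
    n+1 : Carrier
    n+1 = fromℕ (suc n)

  even-factorisation : Appell α (suc n) ≋ F₁ ∘P uPoly
  even-factorisation = ≋-from-derivP (Appell α (suc n)) (F₁ ∘P uPoly) constant-terms
    (≋-from-ev-X (derivP (Appell α (suc n))) (derivP (F₁ ∘P uPoly)) derivP-agree)
    where
    constant-terms : coeff (Appell α (suc n)) 0 ≈ coeff (F₁ ∘P uPoly) 0
    constant-terms = begin
      fromℕ (suc n C 0) * α (suc n) ≈⟨ trans (*-congʳ (+-identityʳ 1#)) (*-identityˡ _) ⟩
      α (suc n)                     ≈⟨ sym (trans (ev-∘P F₁ uPoly X 0) (ev-coeff-0 F₁ u (ev-X uPoly 0))) ⟩
      ev (F₁ ∘P uPoly) X 0          ≈⟨ ev-X (F₁ ∘P uPoly) 0 ⟩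
      coeff (F₁ ∘P uPoly) 0         ∎
      where open ≈-Reasoning

  even-factorisation-unique : ∀ F′ → Appell α (suc n) ≋ F′ ∘P uPoly → F′ ≋ F₁
  even-factorisation-unique F′ A₁≋F′∘u = ev-injective u (ev-X uPoly 0) uPoly-cancel F′ F₁ (begin
    ev F′ u                      ≈⟨ S.sym (ev-∘P F′ uPoly X) ⟩
    ev (F′ ∘P uPoly) X           ≈⟨ S.sym (ev-cong (Appell α (suc n)) (F′ ∘P uPoly) X A₁≋F′∘u) ⟩
    ev (Appell α (suc n)) X      ≈⟨ ev-cong (Appell α (suc n)) (F₁ ∘P uPoly) X even-factorisation ⟩
    ev (F₁ ∘P uPoly) X           ≈⟨ ev-∘P F₁ uPoly X ⟩
    ev F₁ u                      ∎)
    where open ≐-Reasoning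

  coeff-F₁-suc : ∀ j → fromℕ (suc j) * coeff F₁ (suc j) ≈ fromℕ (suc n) * coeff F j
  coeff-F₁-suc j = trans (sym (coeff-derivP F₁ j)) (trans (derivP-F₁ j) (coeff-scaleP (fromℕ (suc n)) F j))

  coeff-F₁-top : coeff F₁ (suc d) ≈ α 0
  coeff-F₁-top = fromℕ-suc-cancel d (begin
    fromℕ (suc d) * coeff F₁ (suc d)         ≈⟨ coeff-F₁-suc d ⟩
    fromℕ (suc n) * coeff F d                ≈⟨ *-congʳ (trans (reflexive (P.cong fromℕ 1+n≡2[1+d])) (fromℕ-* 2 (suc d))) ⟩
    (fromℕ 2 * fromℕ (suc d)) * coeff F d    ≈⟨ trans (*-congʳ (*-comm _ _)) (*-assoc _ _ _) ⟩
    fromℕ (suc d) * (fromℕ 2 * coeff F d)    ≈⟨ *-congˡ two*coeff-F-top ⟩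
    fromℕ (suc d) * α 0                      ∎)
    where
    open ≈-Reasoning
    1+n≡2[1+d] : suc n ≡ 2 ℕ.* suc d
    1+n≡2[1+d] = P.trans (P.cong suc n≡1+2d) (P.trans (P.cong suc (P.sym (ℕP.+-suc d d)))
                          (P.cong (suc d ℕ.+_) (P.sym (ℕP.+-identityʳ (suc d)))))

  coeff-F₁-vanishes : ∀ k → suc d < k → coeff F₁ k ≈ 0#
  coeff-F₁-vanishes (suc j) (s≤s d<j) = fromℕ-suc-cancel j
    (trans (coeff-F₁-suc j) (trans (*-congˡ (coeff-F-vanishes j d<j)) (trans (zeroʳ _) (sym (zeroʳ _)))))

  coeff-F-0 : coeff F 0 ≈ - α n
  coeff-F-0 = trans (coeff-F-binomial 0 z≤n) (trans (*-congˡ (trans (*-congʳ (+-identityʳ 1#))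
    (trans (*-identityˡ _) (trans (*-congʳ (+-identityʳ 1#)) (*-identityˡ _)))))
    (trans (*-congʳ (*-identityʳ (- 1#))) (trans (sym (-‿distribˡ-* 1# (α n))) (-‿cong (*-identityˡ _)))))

odd⇒≡1+2[n/2] : ∀ n → n DM.% 2 ≡ 1 → n ≡ suc (n DM./ 2 ℕ.+ n DM./ 2)
odd⇒≡1+2[n/2] n n%2≡1 = P.trans (DM.m≡m%n+[m/n]*n n 2)
  (P.cong₂ ℕ._+_ n%2≡1 (P.trans (ℕP.*-comm (n DM./ 2) 2) (P.cong (n DM./ 2 ℕ.+_) (ℕP.+-identityʳ (n DM./ 2)))))

[1+n]/2≡1+n/2 : ∀ n → n DM.% 2 ≡ 1 → suc n DM./ 2 ≡ suc (n DM./ 2)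
[1+n]/2≡1+n/2 n n%2≡1 = P.trans (P.cong (DM._/ 2) 1+n≡[1+d]*2) (DM.m*n/n≡m (suc d) 2)
  where
  d = n DM./ 2
  1+n≡[1+d]*2 : suc n ≡ suc d ℕ.* 2
  1+n≡[1+d]*2 = P.trans (P.cong suc (odd⇒≡1+2[n/2] n n%2≡1))
    (P.trans (P.cong suc (P.sym (ℕP.+-suc d d))) (P.trans (P.cong (suc d ℕ.+_) (P.sym (ℕP.+-identityʳ (suc d))))
    (ℕP.*-comm 2 (suc d))))

theorem5p3 : ∀ {c ℓ} (R : CommutativeRing c ℓ) →
  let open CommutativeRing R
      open Defs.Over R
  in IsCharZeroField →
     (α : ℕ → Carrier) →
     (∀ m → (Appell α m ∘P oneMinusX) ≋ scaleP (sgn m) (Appell α m)) →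
     (n : ℕ) → n DM.% 2 ≡ 1 →
     let d = n DM./ 2
         d' = ℕ.suc n DM./ 2
     in Σ Poly λ F →
          (Appell α n ≋ twoXminus1 *P (F ∘P uPoly))
        × (∀ F' → Appell α n ≋ twoXminus1 *P (F' ∘P uPoly) → F' ≋ F)
        × (∀ k → sgn k * coeff F k ≈ Cser α n (ℤ.+ (2 ℕ.* k)) k)
        × (∀ k → fromℕ (k ℕ.!) * Cser α n (ℤ.+ (2 ℕ.* k)) k
                   ≈ evalL 1# 1# (derivLⁿ k (G α n (ℤ.+ (2 ℕ.* k)))))
        × (∀ k → d ℕ.< k → IsPolynomial (Cser α n (ℤ.+ (2 ℕ.* k)))
                           × AntiPalindromic (2 ℕ.* k) (Cser α n (ℤ.+ (2 ℕ.* k))))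
        × (coeff F 0 ≈ - α n)
        × (fromℕ 2 * coeff F d ≈ α 0)
        × (∀ k → d ℕ.< k → coeff F k ≈ 0#)
        × (∀ k → k ℕ.≤ n → coeff F k
              ≈ sgn k * sumTo k (λ ν → fromℤ (gbinom (ℤ.+ (2 ℕ.* k) ℤ.- ℤ.+ n) (k ℕ.∸ ν))
                                        * aCoef α n ν))
        × (∀ k → k ℕ.≤ n → coeff F k
              ≈ sgn (ℕ.suc k) * sumTo k (λ ν → fromℕ ((2 ℕ.* k ℕ.∸ ν) Comb.C k)
                                            * (fromℕ (n Comb.C ν) * α (n ℕ.∸ ν))))
        × (Σ Poly λ F₁ →
              (Appell α (ℕ.suc n) ≋ F₁ ∘P uPoly)
            × (∀ F' → Appell α (ℕ.suc n) ≋ F' ∘P uPoly → F' ≋ F₁)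
            × (coeff F₁ 0 ≈ α (ℕ.suc n))
            × (∀ k → 1 ℕ.≤ k → k ℕ.< d' → fromℕ k * coeff F₁ k ≈ fromℕ (ℕ.suc n) * coeff F (k ℕ.∸ 1))
            × (coeff F₁ d' ≈ α 0)
            × (∀ k → d' ℕ.< k → coeff F₁ k ≈ 0#))
theorem5p3 R (invertible , nonzero) α reflection n n%2≡1 =
  F , Appell-factorisation , factorisation-unique , sgn*coeff-F≈Cser , (λ k → k!*Cser≈derivative-G (+ (2 ℕ.* k)) k) ,
  Cser-polynomial-antipalindromic , coeff-F-0 , two*coeff-F-top , coeff-F-vanishes , coeff-F-aCoef , coeff-F-binomial ,
  ( F₁ , even-factorisation , even-factorisation-unique , CR.refl
  , (λ { (suc j) _ _ → coeff-F₁-suc j })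
  , P.subst (λ m → Over.coeff R F₁ m CR.≈ α 0) (P.sym 1+n/2) coeff-F₁-top
  , (λ k d′<k → coeff-F₁-vanishes k (P.subst (ℕ._< k) 1+n/2 d′<k)) )
  where
  module CR = CommutativeRing R
  inverse : ℕ → CR.Carrier
  inverse m = proj₁ (invertible (Over.fromℕ R (suc m)) (nonzero m))
  open OddAppell R inverse (λ m → proj₂ (invertible (Over.fromℕ R (suc m)) (nonzero m))) α n (n DM./ 2)
                 (odd⇒≡1+2[n/2] n n%2≡1) (reflection n)
  1+n/2 : suc n DM./ 2 ≡ suc (n DM./ 2)
  1+n/2 = [1+n]/2≡1+n/2 n n%2≡1
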